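{- Let $a_1,\ldots,a_n$ be positive integers with $a_1>1$ and $a_n>1$. 1. If $n$ is even, then $\mathcal N^\circ_D[a_1,\ldots,a_n]=\mathcal N[a_1,\ldots,a_n]-\mathcal N[a_2,\ldots,a_n-1]$ and $\mathcal N^\circ_N[a_1,\ldots,a_n]=\mathcal N[a_1,\ldots,a_n]-\mathcal N[a_1-1,\ldots,a_{n-1}]$. 2. If $n$ is odd, then $\mathcal N^\circ_D[a_1,\ldots,a_n]=\mathcal N[a_1,\ldots,a_n]-\mathcal N[a_2,\ldots,a_{n-1}]$ and $\mathcal N^\circ_N[a_1,\ldots,a_n]=\mathcal N[a_1,\ldots,a_n]-\mathcal N[a_1-1,\ldots,a_n-1]$. In the case $n=1$, $\mathcal N^\circ_D[a_1]=a_1$ and $\mathcal N^\circ_N[a_1]=2$.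
   Context: Continued fractions. $[b_1,\ldots,b_n]=b_1+1/(b_2+1/(\cdots+1/b_n))$, and $\mathcal N[b_1,\ldots,b_n]$ is its numerator in lowest terms, with $\mathcal N[\,]=1$. Snake graphs. A snake graph $G=(G_1,\ldots,G_d)$ is a sequence of unit square tiles, each $G_{i+1}$ glued to $G_i$ along the north edge $N(G_i)$ or the east edge $E(G_i)$ ($S,W$ denote south and west edges). Sign functions and $\mathcal G[a_1,\ldots,a_n]$. A sign function labels edges by $\pm$ so that in every tile south and east agree, north and west agree, and north and south differ, with $S(G_1)$ labelled $-$. The sign sequence is $(f_1,\ldots,f_{d+1})$: $f_1$ is the sign of $S(G_1)$, $f_{i+1}$ is the sign of the edge shared by $G_i,G_{i+1}$, and $f_{d+1}=f_d$. $\mathcal G[a_1,\ldots,a_n]$ is the unique snake graph whose sign sequence has maximal blocks of equal signs of lengths $a_1,\ldots,a_n$. Its number of perfect matchings is $\mathcal N[a_1,\ldots,a_n]$. Matchings and dominant edges. Boundary edges lie on exactly one tile. The minimal matching is the perfect matching using only boundary edges and containing $S(G_1)$. The dominant edge of $G_1$ is the edge in $\{S(G_1),W(G_1)\}$ whose two endpoints belong only to $G_1$. Band graphs and good matchings. A band graph from $G$ identifies an edge $e\in\{S(G_1),W(G_1)\}$ with an edge $e'\in\{N(G_d),E(G_d)\}$ chosen so that exactly one of $e,e'$ lies in the minimal matching. $\mathcal G^\circ_D[a_1,\ldots,a_n]$ (resp. $\mathcal G^\circ_N[a_1,\ldots,a_n]$) is the band graph from $\mathcal G[a_1,\ldots,a_n]$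 in which $e$ is the dominant (resp. non-dominant) edge of $G_1$. A good matching of a band graph is a perfect matching of the underlying snake graph that contains $e$ or $e'$. $\mathcal N^\circ_X[a_1,\ldots,a_n]$ ($X\in\{D,N\}$) is the number of good matchings of $\mathcal G^\circ_X[a_1,\ldots,a_n]$. -}

module Defs where

open import Data.Nat using (ℕ; zero; suc; _+_; _*_; _/_; _≡ᵇ_; _∸_)
open import Data.Nat.GCD using (gcd)
open import Data.Bool using (Bool; true; false; _∧_; _∨_; not; _xor_; if_then_else_)
open import Data.List using (List; []; _∷_; _++_; map; length)
open import Data.List.Membership.Propositional using (_∈_)
open import Data.Product using (_×_; _,_)
open import Data.Integer using (ℤ; +_)
open import Relation.Binary.PropositionalEquality using (_≡_)

-- Continued fractions
-- contPair [b₁,…,bₙ] = (p , q) with [b₁,…,bₙ] = p / q (for positive bᵢ),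
-- computed by [b₁,…] = b₁ + 1/[b₂,…] = (b₁ p' + q') / p'.
-- contPair [] = (1 , 0) (so that [b] = b/1).

contPair : List ℕ → ℕ × ℕ
contPair [] = 1 , 0
contPair (b ∷ bs) with contPair bs
... | p , q = b * p + q , p

-- safe quotient (the divisor is never 0 where it matters)
quot : ℕ → ℕ → ℕ
quot m zero = zero
quot m (suc k) = m / suc k

-- 𝒩[b₁,…,bₙ] : numerator in lowest terms; 𝒩[] = 1
cfNum : List ℕ → ℕ
cfNum bs with contPair bs
... | p , q = quot p (gcd p q)

countB : {A : Set} → (A → Bool) → List A → ℕ
countB f [] = 0
countB f (x ∷ xs) = if f x then suc (countB f xs) else countB f xs

filterB : {A : Set} → (A → Bool) → List A → List A
filterB f [] = []
filterB f (x ∷ xs) = if f x then x ∷ filterB f xs else filterB f xs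

allB : {A : Set} → (A → Bool) → List A → Bool
allB f [] = true
allB f (x ∷ xs) = f x ∧ allB f xs

anyB : {A : Set} → (A → Bool) → List A → Bool
anyB f [] = false
anyB f (x ∷ xs) = f x ∨ anyB f xs

nubB : {A : Set} → (A → A → Bool) → List A → List A
nubB eq [] = []
nubB eq (x ∷ xs) = x ∷ filterB (λ y → not (eq x y)) (nubB eq xs)

-- all sublists (= all subsets of a duplicate-free list)
sublists : {A : Set} → List A → List (List A)
sublists [] = [] ∷ []
sublists (x ∷ xs) = map (x ∷_) (sublists xs) ++ sublists xs

Point : Set
Point = ℕ × ℕ

eqP : Point → Point → Bool
eqP (x , y) (x' , y') = (x ≡ᵇ x') ∧ (y ≡ᵇ y')

-- hor x y : segment (x,y)–(x+1,y);  ver x y : segment (x,y)–(x,y+1)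
data Edge : Set where
  hor ver : ℕ → ℕ → Edge

eqE : Edge → Edge → Bool
eqE (hor x y) (hor x' y') = (x ≡ᵇ x') ∧ (y ≡ᵇ y')
eqE (ver x y) (ver x' y') = (x ≡ᵇ x') ∧ (y ≡ᵇ y')
eqE _ _ = false

elemE : Edge → List Edge → Bool
elemE e = anyB (eqE e)

elemP : Point → List Point → Bool
elemP p = anyB (eqP p)

endpoints : Edge → List Point
endpoints (hor x y) = (x , y) ∷ (suc x , y) ∷ []
endpoints (ver x y) = (x , y) ∷ (x , suc y) ∷ []

-- Tiles: a tile is given by its south-west corner

Tile : Set
Tile = Point

S W N E : Tile → Edge
S (x , y) = hor x y
N (x , y) = hor x (suc y)
W (x , y) = ver x y
E (x , y) = ver (suc x) y

tileEdges : Tile → List Edge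
tileEdges t = S t ∷ W t ∷ N t ∷ E t ∷ []

corners : Tile → List Point
corners (x , y) = (x , y) ∷ (suc x , y) ∷ (x , suc y) ∷ (suc x , suc y) ∷ []

-- A snake graph (G₁,…,G_d) is encoded by the list of
-- d-1 gluing directions: G_{i+1} is glued to the north edge (nor) or
-- to the east edge (eas) of G_i.

data Dir : Set where
  nor eas : Dir

Snake : Set
Snake = List Dir

tilesFrom : Tile → List Dir → List Tile
tilesFrom t [] = t ∷ []
tilesFrom (x , y) (nor ∷ ds) = (x , y) ∷ tilesFrom (x , suc y) ds
tilesFrom (x , y) (eas ∷ ds) = (x , y) ∷ tilesFrom (suc x , y) ds

tiles : Snake → List Tile
tiles = tilesFrom (0 , 0)

firstTile : Snake → Tile
firstTile _ = 0 , 0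

laterTiles : Snake → List Tile
laterTiles ds with tiles ds
... | [] = []
... | _ ∷ ts = ts

lastTileFrom : Tile → List Dir → Tile
lastTileFrom t [] = t
lastTileFrom (x , y) (nor ∷ ds) = lastTileFrom (x , suc y) ds
lastTileFrom (x , y) (eas ∷ ds) = lastTileFrom (suc x , y) ds

lastTile : Snake → Tile
lastTile = lastTileFrom (0 , 0)

edges : Snake → List Edge
edges G = nubB eqE (concatTE (tiles G))
  where
  concatTE : List Tile → List Edge
  concatTE [] = []
  concatTE (t ∷ ts) = tileEdges t ++ concatTE ts

vertices : Snake → List Point
vertices G = nubB eqP (concatC (tiles G))
  where
  concatC : List Tile → List Point
  concatC [] = []
  concatC (t ∷ ts) = corners t ++ concatC ts

-- In each tile: sign S = sign E, sign N = sign W, sign N ≠ sign S.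
-- S(G₁) has sign minus.  If G_{i+1} is glued along N(G_i), the shared
-- edge N(G_i) = S(G_{i+1}); if along E(G_i), then E(G_i) = W(G_{i+1}).

data Sign : Set where
  plus minus : Sign

neg : Sign → Sign
neg plus = minus
neg minus = plus

eqSign : Sign → Sign → Bool
eqSign plus plus = true
eqSign minus minus = true
eqSign _ _ = false

-- go f s ds : f = f_i (last sign emitted), s = sign of S(G_i);
-- emits f_{i+1}, …, f_{d+1}
signTail : Sign → Sign → List Dir → List Sign
signTail f s [] = f ∷ []                                   -- f_{d+1} = f_d
signTail f s (nor ∷ ds) = neg s ∷ signTail (neg s) (neg s) ds  -- shared N(G_i); S(G_{i+1}) = it
signTail f s (eas ∷ ds) = s ∷ signTail s (neg s) ds            -- shared E(G_i) (sign of S(G_i)); W(G_{i+1}) = it, so S(G_{i+1}) = neg s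

signSeq : Snake → List Sign
signSeq G = minus ∷ signTail minus minus G

blocksFrom : Sign → ℕ → List Sign → List ℕ
blocksFrom x k [] = k ∷ []
blocksFrom x k (y ∷ ys) = if eqSign x y then blocksFrom x (suc k) ys else k ∷ blocksFrom y 1 ys

blocks : List Sign → List ℕ
blocks [] = []
blocks (x ∷ xs) = blocksFrom x 1 xs

IsSnakeOf : Snake → List ℕ → Set
IsSnakeOf G a = blocks (signSeq G) ≡ a

isPerfectMatching : Snake → List Edge → Bool
isPerfectMatching G M =
  allB (λ v → countB (λ e → elemP v (endpoints e)) M ≡ᵇ 1) (vertices G)

perfectMatchings : Snake → List (List Edge)
perfectMatchings G = filterB (isPerfectMatching G) (sublists (edges G))

isBoundary : Snake → Edge → Bool
isBoundary G e = countB (λ t → elemE e (tileEdges t)) (tiles G) ≡ᵇ 1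

isMinimalMatching : Snake → List Edge → Bool
isMinimalMatching G M = allB (isBoundary G) M ∧ elemE (S (firstTile G)) M

data FirstEdge : Set where
  south west : FirstEdge

otherFirst : FirstEdge → FirstEdge
otherFirst south = west
otherFirst west = south

firstEdge : Snake → FirstEdge → Edge
firstEdge G south = S (firstTile G)
firstEdge G west = W (firstTile G)

data LastEdge : Set where
  north east : LastEdge

lastEdge : Snake → LastEdge → Edge
lastEdge G north = N (lastTile G)
lastEdge G east = E (lastTile G)

isDominant : Snake → FirstEdge → Bool
isDominant G c =
  allB (λ p → not (anyB (λ t → elemP p (corners t)) (laterTiles G)))
       (endpoints (firstEdge G c))

isNonDominant : Snake → FirstEdge → Bool
isNonDominant G c = isDominant G (otherFirst c)

BandOK : Snake → FirstEdge → LastEdge → Set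
BandOK G c c' = (M : List Edge) → M ∈ perfectMatchings G →
  isMinimalMatching G M ≡ true →
  (elemE (firstEdge G c) M xor elemE (lastEdge G c') M) ≡ true

-- number of good matchings of the band graph obtained by identifying
-- firstEdge G c with lastEdge G c'
goodCount : Snake → FirstEdge → LastEdge → ℕ
goodCount G c c' = length (filterB
  (λ M → elemE (firstEdge G c) M ∨ elemE (lastEdge G c') M)
  (perfectMatchings G))

NcircD≡ : List ℕ → ℤ → Set
NcircD≡ a x = (G : Snake) → IsSnakeOf G a →
  (c : FirstEdge) → isDominant G c ≡ true →
  (c' : LastEdge) → BandOK G c c' → + goodCount G c c' ≡ x

NcircN≡ : List ℕ → ℤ → Set
NcircN≡ a x = (G : Snake) → IsSnakeOf G a →
  (c : FirstEdge) → isNonDominant G c ≡ true →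
  (c' : LastEdge) → BandOK G c c' → + goodCount G c c' ≡ x

-- A perfect matching of a snake graph contains exactly one of S(G₁) and W(G₁). Scanning the tiles
-- in order, the numbers of completions through the south and through the west side of the current
-- tile obey a transfer recursion that is the continued-fraction recursion in disguise: inside a
-- block of equal signs one count absorbs the other, at a sign change the two swap roles. Hence
-- G = 𝒢[a] has 𝒩[a] perfect matchings, and forbidding N or E of the last tile yields the continued
-- fraction whose last block is shortened by one or removed, according to the final sign.
--
-- A good matching is a perfect matching containing e or e′, so 𝒩°[a] = 𝒩[a] − #(perfect matchings
-- avoiding e and e′). Those contain the other edge of G₁ and avoid e′. The band condition, read off
-- the minimal matching, determines e′, and the parity of n then decides how the last block changes.
-- Since a₁ > 1 the snake starts with an east step, so W(G₁) is the dominant edge: for e = W(G₁) the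
-- count is the denominator of the changed fraction, 𝒩[a₂, …]; for e = S(G₁) it is numerator minus
-- denominator, which is 𝒩 with a₁ lowered by one.

module Submission where

open import Defs
import Algebra.Solver.IdempotentCommutativeMonoid as ∧-Solver
open import Data.Bool using (Bool; true; false; T; _∧_; _∨_; not; if_then_else_; _xor_)
open import Data.Bool.Properties using (∧-assoc; ∧-identityʳ; ∧-zeroʳ; not-involutive; ∧-idempotentCommutativeMonoid)
open import Data.Empty using (⊥-elim)
open import Data.List using (List; []; _∷_; _++_; map; length)
open import Data.List.Properties using (length-++)
open import Data.List.Membership.Propositional using (_∈_)
open import Data.List.Membership.Propositional.Properties using (∈-map⁺; ∈-++⁺ˡ; ∈-++⁺ʳ)
open import Data.List.Relation.Unary.All as All using (All; []; _∷_)
open import Data.List.Relation.Unary.Any using (here; there)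
open import Data.List.Relation.Binary.Sublist.Propositional using (_⊆_; []; _∷_; _∷ʳ_)
open import Data.List.Relation.Binary.Sublist.Propositional.Properties using (All-resp-⊆)
open import Data.Nat using (ℕ; zero; suc; _+_; _*_; _∸_; _≤_; _<_; z≤n; s≤s; _≡ᵇ_; _%_)
open import Data.Nat.Divisibility using (_∣_; ∣-trans; ∣m+n∣m⇒∣n; ∣1⇒≡1; n∣m*n)
open import Data.Nat.DivMod using (n/1≡n)
open import Data.Nat.GCD using (gcd; gcd[m,n]∣m; gcd[m,n]∣n; gcd-greatest)
open import Data.Nat.Properties using (≡ᵇ⇒≡; +-suc; +-identityʳ; +-comm; +-assoc; *-identityˡ; *-identityʳ; *-zeroʳ; +-cancelʳ-≡; ≤-refl; ≤-reflexive; ≤-trans; n≤1+n; m≤n+m; <-irrefl; <⇒≤; ≤-<-trans; <⇒≢; >⇒≢; m+n∸m≡n; m+n∸n≡m)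
open import Data.Nat.Solver using (module +-*-Solver)
open import Data.Product using (_×_; _,_; proj₁; proj₂; ∃-syntax)
open import Data.Product.Properties using (,-injectiveˡ; ,-injectiveʳ)
open import Data.Sum using (_⊎_; inj₁; inj₂)
open import Data.Unit using (⊤; tt)
open import Relation.Binary.PropositionalEquality using (_≡_; _≢_; refl; sym; trans; cong; cong₂; subst; module ≡-Reasoning)
open import Relation.Nullary using (¬_)

toℕ : Bool → ℕ
toℕ true = 1
toℕ false = 0

sum² : (Bool → Bool → ℕ) → ℕ
sum² f = (f true true + f true false) + (f false true + f false false)

sum³ : (Bool → Bool → Bool → ℕ) → ℕ
sum³ f = sum² (f true) + sum² (f false)

sum²-cong : ∀ {f g : Bool → Bool → ℕ} → (∀ a b → f a b ≡ g a b) → sum² f ≡ sum² g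
sum²-cong f≡g = cong₂ _+_ (cong₂ _+_ (f≡g true true) (f≡g true false)) (cong₂ _+_ (f≡g false true) (f≡g false false))

sum³-cong : ∀ {f g : Bool → Bool → Bool → ℕ} → (∀ a b c → f a b c ≡ g a b c) → sum³ f ≡ sum³ g
sum³-cong f≡g = cong₂ _+_ (sum²-cong (f≡g true)) (sum²-cong (f≡g false))

consIf : ∀ {A : Set} → Bool → A → List A → List A
consIf true x xs = x ∷ xs
consIf false x xs = xs

countSublists : (List Edge → Bool) → List Edge → ℕ
countSublists P es = length (filterB P (sublists es))

filterB-++ : {A : Set} (p : A → Bool) (xs ys : List A) →
  filterB p (xs ++ ys) ≡ filterB p xs ++ filterB p ys
filterB-++ p [] ys = refl
filterB-++ p (x ∷ xs) ys with p x
... | true = cong (x ∷_) (filterB-++ p xs ys)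
... | false = filterB-++ p xs ys

length-filterB-map : {A B : Set} (p : B → Bool) (f : A → B) (xs : List A) →
  length (filterB p (map f xs)) ≡ length (filterB (λ x → p (f x)) xs)
length-filterB-map p f [] = refl
length-filterB-map p f (x ∷ xs) with p (f x)
... | true = cong suc (length-filterB-map p f xs)
... | false = length-filterB-map p f xs

length-filterB-split : {A : Set} (p q : A → Bool) (xs : List A) →
  length (filterB p xs) ≡
  length (filterB (λ x → p x ∧ q x) xs) + length (filterB (λ x → p x ∧ not (q x)) xs)
length-filterB-split p q [] = refl
length-filterB-split p q (x ∷ xs) with p x | q x
... | true | true = cong suc (length-filterB-split p q xs)
... | true | false = trans (cong suc (length-filterB-split p q xs)) (sym (+-suc _ _))
... | false | _ = length-filterB-split p q xs

length-filterB-filterB : {A : Set} (p q : A → Bool) (xs : List A) →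
  length (filterB q (filterB p xs)) ≡ length (filterB (λ x → p x ∧ q x) xs)
length-filterB-filterB p q [] = refl
length-filterB-filterB p q (x ∷ xs) with p x
... | false = length-filterB-filterB p q xs
... | true with q x
... | true = cong suc (length-filterB-filterB p q xs)
... | false = length-filterB-filterB p q xs

countSublists-∷ : (P : List Edge → Bool) (e : Edge) (es : List Edge) →
  countSublists P (e ∷ es) ≡ countSublists (λ M → P (e ∷ M)) es + countSublists P es
countSublists-∷ P e es = begin
  length (filterB P (map (e ∷_) (sublists es) ++ sublists es))
    ≡⟨ cong length (filterB-++ P (map (e ∷_) (sublists es)) (sublists es)) ⟩
  length (filterB P (map (e ∷_) (sublists es)) ++ filterB P (sublists es))
    ≡⟨ length-++ (filterB P (map (e ∷_) (sublists es))) ⟩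
  length (filterB P (map (e ∷_) (sublists es))) + countSublists P es
    ≡⟨ cong (_+ countSublists P es) (length-filterB-map P (e ∷_) (sublists es)) ⟩
  countSublists (λ M → P (e ∷ M)) es + countSublists P es ∎
  where open ≡-Reasoning

countSublists-∷² : (P : List Edge → Bool) (a b : Edge) (es : List Edge) →
  countSublists P (a ∷ b ∷ es) ≡ sum² λ i j → countSublists (λ M → P (consIf i a (consIf j b M))) es
countSublists-∷² P a b es =
  trans (countSublists-∷ P a (b ∷ es))
        (cong₂ _+_ (countSublists-∷ (λ M → P (a ∷ M)) b es) (countSublists-∷ P b es))

countSublists-∷³ : (P : List Edge → Bool) (a b c : Edge) (es : List Edge) →
  countSublists P (a ∷ b ∷ c ∷ es) ≡ sum³ λ i j k → countSublists (λ M → P (consIf i a (consIf j b (consIf k c M)))) es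
countSublists-∷³ P a b c es =
  trans (countSublists-∷ P a (b ∷ c ∷ es))
        (cong₂ _+_ (countSublists-∷² (λ M → P (a ∷ M)) b c es) (countSublists-∷² P b c es))

countSublists-[] : (P : List Edge → Bool) → countSublists P [] ≡ toℕ (P [])
countSublists-[] P with P []
... | true = refl
... | false = refl

countSublists-cong : (R : Edge → Set) (P Q : List Edge → Bool) (es : List Edge) → All R es →
  (∀ M → All R M → P M ≡ Q M) → countSublists P es ≡ countSublists Q es
countSublists-cong R P Q [] [] P≡Q =
  trans (countSublists-[] P) (trans (cong toℕ (P≡Q [] [])) (sym (countSublists-[] Q)))
countSublists-cong R P Q (e ∷ es) (r ∷ rs) P≡Q = begin
  countSublists P (e ∷ es)
    ≡⟨ countSublists-∷ P e es ⟩
  countSublists (λ M → P (e ∷ M)) es + countSublists P es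
    ≡⟨ cong₂ _+_ (countSublists-cong R _ _ es rs (λ M rM → P≡Q (e ∷ M) (r ∷ rM)))
                 (countSublists-cong R P Q es rs P≡Q) ⟩
  countSublists (λ M → Q (e ∷ M)) es + countSublists Q es
    ≡⟨ countSublists-∷ Q e es ⟨
  countSublists Q (e ∷ es) ∎
  where open ≡-Reasoning

countSublists-ext : (P Q : List Edge → Bool) (es : List Edge) →
  (∀ M → P M ≡ Q M) → countSublists P es ≡ countSublists Q es
countSublists-ext P Q es P≡Q =
  countSublists-cong (λ _ → ⊤) P Q es (All.universal (λ _ → tt) es) (λ M _ → P≡Q M)

countSublists-false : (es : List Edge) → countSublists (λ _ → false) es ≡ 0
countSublists-false [] = refl
countSublists-false (e ∷ es) =
  trans (countSublists-∷ (λ _ → false) e es) (cong₂ _+_ (countSublists-false es) (countSublists-false es))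

countSublists-∧ˡ : (b : Bool) (P : List Edge → Bool) (es : List Edge) →
  countSublists (λ M → b ∧ P M) es ≡ (if b then countSublists P es else 0)
countSublists-∧ˡ true P es = refl
countSublists-∧ˡ false P es = countSublists-false es

countSublists-zero : (R : Edge → Set) (P : List Edge → Bool) (es : List Edge) → All R es →
  (∀ M → All R M → P M ≡ false) → countSublists P es ≡ 0
countSublists-zero R P es rs P≡false =
  trans (countSublists-cong R P (λ _ → false) es rs P≡false) (countSublists-false es)

≡ᵇ-refl : ∀ n → (n ≡ᵇ n) ≡ true
≡ᵇ-refl zero = refl
≡ᵇ-refl (suc n) = ≡ᵇ-refl n

≡ᵇ-≡ : ∀ m n → (m ≡ᵇ n) ≡ true → m ≡ n
≡ᵇ-≡ m n eq = ≡ᵇ⇒≡ m n (subst T (sym eq) tt)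

eqP-refl : ∀ p → eqP p p ≡ true
eqP-refl (x , y) rewrite ≡ᵇ-refl x | ≡ᵇ-refl y = refl

eqP-≡ : ∀ p q → eqP p q ≡ true → p ≡ q
eqP-≡ (x , y) (x′ , y′) eq with x ≡ᵇ x′ in ex | y ≡ᵇ y′ in ey
... | true | true = cong₂ _,_ (≡ᵇ-≡ x x′ ex) (≡ᵇ-≡ y y′ ey)

eqP-≢ : ∀ p q → p ≢ q → eqP p q ≡ false
eqP-≢ (x , y) (x′ , y′) p≢q with x ≡ᵇ x′ in ex | y ≡ᵇ y′ in ey
... | false | _ = refl
... | true | false = refl
... | true | true = ⊥-elim (p≢q (cong₂ _,_ (≡ᵇ-≡ x x′ ex) (≡ᵇ-≡ y y′ ey)))

<ˣ⇒≢ : ∀ {a b c d : ℕ} → a < c → (a , b) ≢ (c , d)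
<ˣ⇒≢ a<c eq = <⇒≢ a<c (,-injectiveˡ eq)

>ˣ⇒≢ : ∀ {a b c d : ℕ} → c < a → (a , b) ≢ (c , d)
>ˣ⇒≢ c<a eq = >⇒≢ c<a (,-injectiveˡ eq)

<ʸ⇒≢ : ∀ {a b c d : ℕ} → b < d → (a , b) ≢ (c , d)
<ʸ⇒≢ b<d eq = <⇒≢ b<d (,-injectiveʳ eq)

>ʸ⇒≢ : ∀ {a b c d : ℕ} → d < b → (a , b) ≢ (c , d)
>ʸ⇒≢ d<b eq = >⇒≢ d<b (,-injectiveʳ eq)

anchor : Edge → Point
anchor (hor a b) = a , b
anchor (ver a b) = a , b

eqE-refl : ∀ e → eqE e e ≡ true
eqE-refl (hor a b) = eqP-refl (a , b)
eqE-refl (ver a b) = eqP-refl (a , b)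

eqE-≢ : ∀ e e′ → anchor e ≢ anchor e′ → eqE e e′ ≡ false
eqE-≢ (hor a b) (hor c d) ne = eqP-≢ (a , b) (c , d) ne
eqE-≢ (hor a b) (ver c d) ne = refl
eqE-≢ (ver a b) (hor c d) ne = refl
eqE-≢ (ver a b) (ver c d) ne = eqP-≢ (a , b) (c , d) ne

_≼_ : Point → Point → Set
(x , y) ≼ (a , b) = (x ≤ a) × (y ≤ b)

≼-refl : ∀ p → p ≼ p
≼-refl (x , y) = ≤-refl , ≤-refl

≼-trans : ∀ p q r → p ≼ q → q ≼ r → p ≼ r
≼-trans (x , y) (a , b) (c , d) (x≤a , y≤b) (a≤c , b≤d) = ≤-trans x≤a a≤c , ≤-trans y≤b b≤d

After : Tile → Edge → Set
After t e = t ≼ anchor e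

StrictlyAfter : Tile → Edge → Set
StrictlyAfter t e = After t e × anchor e ≢ t

Fresh : Edge → List Edge → Set
Fresh e = All (λ e′ → eqE e e′ ≡ false)

fresh-strictlyAfter : ∀ e t es → All (StrictlyAfter t) es →
  (anchor e ≡ t) ⊎ ¬ (t ≼ anchor e) → Fresh e es
fresh-strictlyAfter e t es after (inj₁ refl) = All.map (λ (_ , ne) → eqE-≢ e _ (λ eq → ne (sym eq))) after
fresh-strictlyAfter e t es after (inj₂ t⋠e) = All.map (λ (t≼e′ , _) → eqE-≢ e _ (λ eq → t⋠e (subst (t ≼_) (sym eq) t≼e′))) after

without : Edge → List Edge → List Edge
without e = filterB (λ e′ → not (eqE e e′))

without-fresh : ∀ e es → Fresh e es → without e es ≡ es
without-fresh e [] [] = refl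
without-fresh e (e′ ∷ es) (eq ∷ fr) rewrite eq = cong (e′ ∷_) (without-fresh e es fr)

without-∷ : ∀ e e′ es → eqE e e′ ≡ true → Fresh e es → without e (e′ ∷ es) ≡ es
without-∷ e e′ es eq fr rewrite eq = without-fresh e es fr

elemE-fresh : ∀ e es → Fresh e es → elemE e es ≡ false
elemE-fresh e [] [] = refl
elemE-fresh e (e′ ∷ es) (eq ∷ fr) rewrite eq = elemE-fresh e es fr

laterEdges : Tile → List Dir → List Edge
laterEdges t [] = N t ∷ E t ∷ []
laterEdges (x , y) (nor ∷ ds) = N (x , y) ∷ E (x , y) ∷ W (x , suc y) ∷ laterEdges (x , suc y) ds
laterEdges (x , y) (eas ∷ ds) = N (x , y) ∷ E (x , y) ∷ S (suc x , y) ∷ laterEdges (suc x , y) ds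

laterEdges-strictlyAfter : ∀ t ds → All (StrictlyAfter t) (laterEdges t ds)
laterEdges-strictlyAfter (x , y) [] = ((≤-refl , n≤1+n y) , >ʸ⇒≢ ≤-refl) ∷ ((n≤1+n x , ≤-refl) , >ˣ⇒≢ ≤-refl) ∷ []
laterEdges-strictlyAfter (x , y) (nor ∷ ds) =
  ((≤-refl , n≤1+n y) , >ʸ⇒≢ ≤-refl) ∷ ((n≤1+n x , ≤-refl) , >ˣ⇒≢ ≤-refl) ∷ ((≤-refl , n≤1+n y) , >ʸ⇒≢ ≤-refl)
  ∷ All.map (λ ((x≤a , sy≤b) , _) → (x≤a , ≤-trans (n≤1+n y) sy≤b) , >ʸ⇒≢ sy≤b) (laterEdges-strictlyAfter (x , suc y) ds)
laterEdges-strictlyAfter (x , y) (eas ∷ ds) =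
  ((≤-refl , n≤1+n y) , >ʸ⇒≢ ≤-refl) ∷ ((n≤1+n x , ≤-refl) , >ˣ⇒≢ ≤-refl) ∷ ((n≤1+n x , ≤-refl) , >ˣ⇒≢ ≤-refl)
  ∷ All.map (λ ((sx≤a , y≤b) , _) → (≤-trans (n≤1+n x) sx≤a , y≤b) , >ˣ⇒≢ sx≤a) (laterEdges-strictlyAfter (suc x , y) ds)

tileEdgeList : List Tile → List Edge
tileEdgeList [] = []
tileEdgeList (t ∷ ts) = tileEdges t ++ tileEdgeList ts

-- Each new tile repeats exactly one edge of its predecessor (the shared one); nubB removes it.
nubB-tileEdgeList : ∀ t ds → nubB eqE (tileEdgeList (tilesFrom t ds)) ≡ S t ∷ W t ∷ laterEdges t ds
nubB-tileEdgeList (x , y) [] = cong (S t ∷_) (trans (cong (without (S t)) (cong (W t ∷_) freshW)) freshS)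
  where
  t : Tile
  t = x , y
  freshW : without (W t) (N t ∷ E t ∷ []) ≡ N t ∷ E t ∷ []
  freshW = without-fresh (W t) _ (refl ∷ eqE-≢ (W t) (E t) (<ˣ⇒≢ ≤-refl) ∷ [])
  freshS : without (S t) (W t ∷ N t ∷ E t ∷ []) ≡ W t ∷ N t ∷ E t ∷ []
  freshS = without-fresh (S t) _ (refl ∷ eqE-≢ (S t) (N t) (<ʸ⇒≢ ≤-refl) ∷ refl ∷ [])
nubB-tileEdgeList (x , y) (nor ∷ ds) rewrite nubB-tileEdgeList (x , suc y) ds =
  cong (S t ∷_) (trans (cong (without (S t)) (cong (W t ∷_) (trans (cong (without (W t)) (cong (N t ∷_)
    (trans (cong (without (N t)) (cong (E t ∷_) freshE)) (cong (E t ∷_) dropN)))) freshW))) freshS)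
  where
  t t′ : Tile
  t = x , y
  t′ = x , suc y
  later = laterEdges t′ ds
  after = laterEdges-strictlyAfter t′ ds
  below : ∀ {a} → ¬ (t′ ≼ (a , y))
  below (_ , sy≤y) = <-irrefl refl sy≤y
  freshE : without (E t) (S t′ ∷ W t′ ∷ later) ≡ S t′ ∷ W t′ ∷ later
  freshE = without-fresh (E t) _ (refl ∷ eqE-≢ (E t) (W t′) (<ʸ⇒≢ ≤-refl) ∷ fresh-strictlyAfter (E t) t′ later after (inj₂ below))
  dropN : without (N t) (S t′ ∷ W t′ ∷ later) ≡ W t′ ∷ later
  dropN = without-∷ (N t) _ _ (eqE-refl (N t)) (refl ∷ fresh-strictlyAfter (N t) t′ later after (inj₁ refl))
  freshW : without (W t) (N t ∷ E t ∷ W t′ ∷ later) ≡ N t ∷ E t ∷ W t′ ∷ later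
  freshW = without-fresh (W t) _ (refl ∷ eqE-≢ (W t) (E t) (<ˣ⇒≢ ≤-refl) ∷ eqE-≢ (W t) (W t′) (<ʸ⇒≢ ≤-refl)
             ∷ fresh-strictlyAfter (W t) t′ later after (inj₂ below))
  freshS : without (S t) (W t ∷ N t ∷ E t ∷ W t′ ∷ later) ≡ W t ∷ N t ∷ E t ∷ W t′ ∷ later
  freshS = without-fresh (S t) _ (refl ∷ eqE-≢ (S t) (N t) (<ʸ⇒≢ ≤-refl) ∷ refl ∷ refl
             ∷ fresh-strictlyAfter (S t) t′ later after (inj₂ below))
nubB-tileEdgeList (x , y) (eas ∷ ds) rewrite nubB-tileEdgeList (suc x , y) ds =
  cong (S t ∷_) (trans (cong (without (S t)) (cong (W t ∷_) (trans (cong (without (W t)) (cong (N t ∷_)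
    (trans (cong (without (N t)) (cong (E t ∷_) dropE)) freshN))) freshW))) freshS)
  where
  t t′ : Tile
  t = x , y
  t′ = suc x , y
  later = laterEdges t′ ds
  after = laterEdges-strictlyAfter t′ ds
  left : ∀ {b} → ¬ (t′ ≼ (x , b))
  left (sx≤x , _) = <-irrefl refl sx≤x
  dropE : without (E t) (S t′ ∷ W t′ ∷ later) ≡ S t′ ∷ later
  dropE = cong (S t′ ∷_) (without-∷ (E t) _ _ (eqE-refl (E t)) (fresh-strictlyAfter (E t) t′ later after (inj₁ refl)))
  freshN : without (N t) (E t ∷ S t′ ∷ later) ≡ E t ∷ S t′ ∷ later
  freshN = without-fresh (N t) _ (refl ∷ eqE-≢ (N t) (S t′) (<ˣ⇒≢ ≤-refl) ∷ fresh-strictlyAfter (N t) t′ later after (inj₂ left))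
  freshW : without (W t) (N t ∷ E t ∷ S t′ ∷ later) ≡ N t ∷ E t ∷ S t′ ∷ later
  freshW = without-fresh (W t) _ (refl ∷ eqE-≢ (W t) (E t) (<ˣ⇒≢ ≤-refl) ∷ refl
             ∷ fresh-strictlyAfter (W t) t′ later after (inj₂ left))
  freshS : without (S t) (W t ∷ N t ∷ E t ∷ S t′ ∷ later) ≡ W t ∷ N t ∷ E t ∷ S t′ ∷ later
  freshS = without-fresh (S t) _ (refl ∷ eqE-≢ (S t) (N t) (<ʸ⇒≢ ≤-refl) ∷ refl ∷ eqE-≢ (S t) (S t′) (<ˣ⇒≢ ≤-refl)
             ∷ fresh-strictlyAfter (S t) t′ later after (inj₂ left))

tileEdgeList-unique : (f : List Tile → List Edge) → (∀ t ts → f (t ∷ ts) ≡ tileEdges t ++ f ts) →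
  f [] ≡ [] → ∀ ts → f ts ≡ tileEdgeList ts
tileEdgeList-unique f f-∷ f-[] [] = f-[]
tileEdgeList-unique f f-∷ f-[] (t ∷ ts) = trans (f-∷ t ts) (cong (tileEdges t ++_) (tileEdgeList-unique f f-∷ f-[] ts))

edges-tileEdgeList : ∀ G → edges G ≡ nubB eqE (tileEdgeList (tiles G))
edges-tileEdgeList G with tiles G | tileEdgeList-unique _ (λ _ _ → refl) refl
... | ts | concat≡ = cong (nubB eqE) (concat≡ ts)

edges≡ : ∀ G → edges G ≡ S (0 , 0) ∷ W (0 , 0) ∷ laterEdges (0 , 0) G
edges≡ G = trans (edges-tileEdgeList G) (nubB-tileEdgeList (0 , 0) G)

-- Perfect matchings as degree conditions

cornerList : List Tile → List Point
cornerList [] = []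
cornerList (t ∷ ts) = corners t ++ cornerList ts

snakeCorners : Tile → List Dir → List Point
snakeCorners t ds = cornerList (tilesFrom t ds)

cornerList-unique : (f : List Tile → List Point) → (∀ t ts → f (t ∷ ts) ≡ corners t ++ f ts) →
  f [] ≡ [] → ∀ ts → f ts ≡ cornerList ts
cornerList-unique f f-∷ f-[] [] = f-[]
cornerList-unique f f-∷ f-[] (t ∷ ts) = trans (f-∷ t ts) (cong (corners t ++_) (cornerList-unique f f-∷ f-[] ts))

vertices-cornerList : ∀ G → vertices G ≡ nubB eqP (cornerList (tiles G))
vertices-cornerList G with tiles G | cornerList-unique _ (λ _ _ → refl) refl
... | ts | concat≡ = cong (nubB eqP) (concat≡ ts)

allB-without : (p : Point → Bool) → (∀ a b → eqP a b ≡ true → p a ≡ p b) → ∀ v vs → p v ≡ true →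
  allB p (filterB (λ w → not (eqP v w)) vs) ≡ allB p vs
allB-without p p-resp v [] pv = refl
allB-without p p-resp v (w ∷ vs) pv with eqP v w in v≡w
... | true rewrite sym (p-resp v w v≡w) | pv = allB-without p p-resp v vs pv
... | false = cong (p w ∧_) (allB-without p p-resp v vs pv)

allB-nubB : (p : Point → Bool) → (∀ a b → eqP a b ≡ true → p a ≡ p b) → ∀ vs →
  allB p (nubB eqP vs) ≡ allB p vs
allB-nubB p p-resp [] = refl
allB-nubB p p-resp (v ∷ vs) with p v in pv
... | true = trans (allB-without p p-resp v (nubB eqP vs) pv) (allB-nubB p p-resp vs)
... | false = refl

degree : List Edge → Point → ℕ
degree M v = countB (λ e → elemP v (endpoints e)) M

completes : (Point → ℕ) → List Point → List Edge → Bool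
completes f vs M = allB (λ v → f v + degree M v ≡ᵇ 1) vs

noDegrees : Point → ℕ
noDegrees _ = 0

isPerfectMatching≡completes : ∀ G M → isPerfectMatching G M ≡ completes noDegrees (snakeCorners (0 , 0) G) M
isPerfectMatching≡completes G M = trans (cong (allB _) (vertices-cornerList G))
  (allB-nubB _ (λ a b a≡b → cong (λ v → degree M v ≡ᵇ 1) (eqP-≡ a b a≡b)) (cornerList (tiles G)))

withEdge : (Point → ℕ) → Edge → Point → ℕ
withEdge f e v = if elemP v (endpoints e) then suc (f v) else f v

withEdgeIf : Bool → Edge → (Point → ℕ) → Point → ℕ
withEdgeIf true e f = withEdge f e
withEdgeIf false e f = f

completes-∷ : ∀ f vs e M → completes f vs (e ∷ M) ≡ completes (withEdge f e) vs M
completes-∷ f [] e M = refl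
completes-∷ f (v ∷ vs) e M with elemP v (endpoints e)
... | true = cong₂ _∧_ (cong (_≡ᵇ 1) (+-suc (f v) (degree M v))) (completes-∷ f vs e M)
... | false = cong (_ ∧_) (completes-∷ f vs e M)

completes-consIf : ∀ b f vs e M → completes f vs (consIf b e M) ≡ completes (withEdgeIf b e f) vs M
completes-consIf true f vs e M = completes-∷ f vs e M
completes-consIf false f vs e M = refl

completes-[] : ∀ f vs → completes f vs [] ≡ allB (λ v → f v ≡ᵇ 1) vs
completes-[] f [] = refl
completes-[] f (v ∷ vs) = cong₂ _∧_ (cong (_≡ᵇ 1) (+-identityʳ (f v))) (completes-[] f vs)

elemP-≢ : ∀ v p q → v ≢ p → v ≢ q → elemP v (p ∷ q ∷ []) ≡ false
elemP-≢ v p q v≢p v≢q rewrite eqP-≢ v p v≢p | eqP-≢ v q v≢q = refl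

elemP-here : ∀ v q → elemP v (v ∷ q ∷ []) ≡ true
elemP-here v q rewrite eqP-refl v = refl

elemP-there : ∀ v p → v ≢ p → elemP v (p ∷ v ∷ []) ≡ true
elemP-there v p v≢p rewrite eqP-≢ v p v≢p | eqP-refl v = refl

degree-notAfter : ∀ t v M → All (After t) M → ¬ (t ≼ v) → degree M v ≡ 0
degree-notAfter t v [] [] t⋠v = refl
degree-notAfter (x , y) v (hor a b ∷ M) ((x≤a , y≤b) ∷ after) t⋠v
  rewrite elemP-≢ v (a , b) (suc a , b) (λ { refl → t⋠v (x≤a , y≤b) }) (λ { refl → t⋠v (≤-trans x≤a (n≤1+n a) , y≤b) })
  = degree-notAfter (x , y) v M after t⋠v
degree-notAfter (x , y) v (ver a b ∷ M) ((x≤a , y≤b) ∷ after) t⋠v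
  rewrite elemP-≢ v (a , b) (a , suc b) (λ { refl → t⋠v (x≤a , y≤b) }) (λ { refl → t⋠v (x≤a , ≤-trans y≤b (n≤1+n b)) })
  = degree-notAfter (x , y) v M after t⋠v

allB-snakeCorners : ∀ x y ds (p : Point → Bool) →
  ∃[ r ] allB p (snakeCorners (x , y) ds) ≡ p (x , y) ∧ (p (suc x , y) ∧ (p (x , suc y) ∧ (p (suc x , suc y) ∧ r)))
allB-snakeCorners x y [] p = _ , refl
allB-snakeCorners x y (nor ∷ ds) p = _ , refl
allB-snakeCorners x y (eas ∷ ds) p = _ , refl

-- No edge of M touches the lower corners of the first tile, whose upper corners recur as the
-- lower corners of the next tile.
completes-nor : ∀ x y ds g M → All (After (x , suc y)) M →
  completes g (snakeCorners (x , y) (nor ∷ ds)) M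
  ≡ ((g (x , y) ≡ᵇ 1) ∧ (g (suc x , y) ≡ᵇ 1)) ∧ completes g (snakeCorners (x , suc y) ds) M
completes-nor x y ds g M after
  rewrite degree-notAfter (x , suc y) (x , y) M after (λ (_ , sy≤y) → <-irrefl refl sy≤y)
        | degree-notAfter (x , suc y) (suc x , y) M after (λ (_ , sy≤y) → <-irrefl refl sy≤y)
        | +-identityʳ (g (x , y)) | +-identityʳ (g (suc x , y))
  with allB-snakeCorners x (suc y) ds (λ v → g v + degree M v ≡ᵇ 1)
... | r , eq rewrite eq =
  solve 7 (λ a b p q s u r → a ⊕ (b ⊕ (p ⊕ (q ⊕ (p ⊕ (q ⊕ (s ⊕ (u ⊕ r))))))) ⊜ (a ⊕ b) ⊕ (p ⊕ (q ⊕ (s ⊕ (u ⊕ r)))))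
    refl (g (x , y) ≡ᵇ 1) (g (suc x , y) ≡ᵇ 1) (ok (x , suc y)) (ok (suc x , suc y))
         (ok (x , suc (suc y))) (ok (suc x , suc (suc y))) r
  where
  open ∧-Solver ∧-idempotentCommutativeMonoid using (solve; _⊜_; _⊕_)
  ok : Point → Bool
  ok v = g v + degree M v ≡ᵇ 1

completes-eas : ∀ x y ds g M → All (After (suc x , y)) M →
  completes g (snakeCorners (x , y) (eas ∷ ds)) M
  ≡ ((g (x , y) ≡ᵇ 1) ∧ (g (x , suc y) ≡ᵇ 1)) ∧ completes g (snakeCorners (suc x , y) ds) M
completes-eas x y ds g M after
  rewrite degree-notAfter (suc x , y) (x , y) M after (λ (sx≤x , _) → <-irrefl refl sx≤x)
        | degree-notAfter (suc x , y) (x , suc y) M after (λ (sx≤x , _) → <-irrefl refl sx≤x)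
        | +-identityʳ (g (x , y)) | +-identityʳ (g (x , suc y))
  with allB-snakeCorners (suc x) y ds (λ v → g v + degree M v ≡ᵇ 1)
... | r , eq rewrite eq =
  solve 7 (λ a b p q s u r → a ⊕ (p ⊕ (b ⊕ (q ⊕ (p ⊕ (s ⊕ (q ⊕ (u ⊕ r))))))) ⊜ (a ⊕ b) ⊕ (p ⊕ (s ⊕ (q ⊕ (u ⊕ r)))))
    refl (g (x , y) ≡ᵇ 1) (g (x , suc y) ≡ᵇ 1) (ok (suc x , y)) (ok (suc x , suc y))
         (ok (suc (suc x) , y)) (ok (suc (suc x) , suc y)) r
  where
  open ∧-Solver ∧-idempotentCommutativeMonoid using (solve; _⊜_; _⊕_)
  ok : Point → Bool
  ok v = g v + degree M v ≡ᵇ 1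

-- The transfer recursion

withEdgeIf-∈ : ∀ b e f v → elemP v (endpoints e) ≡ true → withEdgeIf b e f v ≡ toℕ b + f v
withEdgeIf-∈ true e f v v∈e rewrite v∈e = refl
withEdgeIf-∈ false e f v v∈e = refl

withEdgeIf-∉ : ∀ b e f v → elemP v (endpoints e) ≡ false → withEdgeIf b e f v ≡ f v
withEdgeIf-∉ true e f v v∉e rewrite v∉e = refl
withEdgeIf-∉ false e f v v∉e = refl

level : Point → ℕ
level (a , b) = a + b

Vanishes : (Point → ℕ) → ℕ → Set
Vanishes f k = ∀ p → k ≤ level p → f p ≡ 0

level-≢ : ∀ {p q} k → level q ≤ k → suc k ≤ level p → p ≢ q
level-≢ k q≤k k<p refl = <-irrefl refl (≤-<-trans q≤k k<p)

module _ (x y : ℕ) where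

  level-north : level (x , suc y) ≡ suc (x + y)
  level-north = +-suc x y

  level-north² : level (x , suc (suc y)) ≡ 2 + (x + y)
  level-north² = trans (+-suc x (suc y)) (cong suc (+-suc x y))

  level-northeast : level (suc x , suc y) ≡ 2 + (x + y)
  level-northeast = cong suc (+-suc x y)

module NorthStep (x y : ℕ) (n e w : Bool) (f : Point → ℕ) where

  g : Point → ℕ
  g = withEdgeIf w (W (x , suc y)) (withEdgeIf e (E (x , y)) (withEdgeIf n (N (x , y)) f))

  private
    fN = withEdgeIf n (N (x , y)) f
    fNE = withEdgeIf e (E (x , y)) fN
    skip : ∀ v → v ≢ (x , suc y) → v ≢ (x , suc (suc y)) → v ≢ (suc x , y) → v ≢ (suc x , suc y) → g v ≡ f v
    skip v a b c d = trans (withEdgeIf-∉ w (W (x , suc y)) fNE v (elemP-≢ v (x , suc y) (x , suc (suc y)) a b))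
                       (trans (withEdgeIf-∉ e (E (x , y)) fN v (elemP-≢ v (suc x , y) (suc x , suc y) c d))
                              (withEdgeIf-∉ n (N (x , y)) f v (elemP-≢ v (x , suc y) (suc x , suc y) a d)))

  at-SW : g (x , y) ≡ f (x , y)
  at-SW = skip (x , y) (<ʸ⇒≢ ≤-refl) (<ʸ⇒≢ (n≤1+n (suc y))) (<ˣ⇒≢ ≤-refl) (<ˣ⇒≢ ≤-refl)

  at-SE : g (suc x , y) ≡ toℕ e + f (suc x , y)
  at-SE = trans (withEdgeIf-∉ w (W (x , suc y)) fNE (suc x , y) (elemP-≢ (suc x , y) (x , suc y) (x , suc (suc y)) (>ˣ⇒≢ ≤-refl) (>ˣ⇒≢ ≤-refl)))
         (trans (withEdgeIf-∈ e (E (x , y)) fN (suc x , y) (elemP-here (suc x , y) (suc x , suc y)))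
                (cong (toℕ e +_) (withEdgeIf-∉ n (N (x , y)) f (suc x , y) (elemP-≢ (suc x , y) (x , suc y) (suc x , suc y) (>ˣ⇒≢ ≤-refl) (<ʸ⇒≢ ≤-refl)))))

  at-SW′ : g (x , suc y) ≡ toℕ w + (toℕ n + f (x , suc y))
  at-SW′ = trans (withEdgeIf-∈ w (W (x , suc y)) fNE (x , suc y) (elemP-here (x , suc y) (x , suc (suc y))))
          (cong (toℕ w +_) (trans (withEdgeIf-∉ e (E (x , y)) fN (x , suc y) (elemP-≢ (x , suc y) (suc x , y) (suc x , suc y) (<ˣ⇒≢ ≤-refl) (<ˣ⇒≢ ≤-refl)))
                                  (withEdgeIf-∈ n (N (x , y)) f (x , suc y) (elemP-here (x , suc y) (suc x , suc y)))))

  at-NW′ : g (x , suc (suc y)) ≡ toℕ w + f (x , suc (suc y))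
  at-NW′ = trans (withEdgeIf-∈ w (W (x , suc y)) fNE (x , suc (suc y)) (elemP-there (x , suc (suc y)) (x , suc y) (>ʸ⇒≢ ≤-refl)))
          (cong (toℕ w +_) (trans (withEdgeIf-∉ e (E (x , y)) fN (x , suc (suc y)) (elemP-≢ (x , suc (suc y)) (suc x , y) (suc x , suc y) (<ˣ⇒≢ ≤-refl) (<ˣ⇒≢ ≤-refl)))
                                  (withEdgeIf-∉ n (N (x , y)) f (x , suc (suc y)) (elemP-≢ (x , suc (suc y)) (x , suc y) (suc x , suc y) (>ʸ⇒≢ ≤-refl) (<ˣ⇒≢ ≤-refl)))))

  at-SE′ : g (suc x , suc y) ≡ toℕ e + (toℕ n + f (suc x , suc y))
  at-SE′ = trans (withEdgeIf-∉ w (W (x , suc y)) fNE (suc x , suc y) (elemP-≢ (suc x , suc y) (x , suc y) (x , suc (suc y)) (>ˣ⇒≢ ≤-refl) (>ˣ⇒≢ ≤-refl)))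
          (trans (withEdgeIf-∈ e (E (x , y)) fN (suc x , suc y) (elemP-there (suc x , suc y) (suc x , y) (>ʸ⇒≢ ≤-refl)))
                 (cong (toℕ e +_) (withEdgeIf-∈ n (N (x , y)) f (suc x , suc y) (elemP-there (suc x , suc y) (x , suc y) (>ˣ⇒≢ ≤-refl)))))

  vanishes : Vanishes f (2 + (x + y)) → Vanishes g (2 + level (x , suc y))
  vanishes f-vanishes p far =
    trans (skip p (low₁ (level-north x y)) (low₂ (level-north² x y)) (low₁ refl) (low₂ (level-northeast x y)))
          (f-vanishes p (≤-trans (n≤1+n _) far′))
    where
    far′ : 3 + (x + y) ≤ level p
    far′ = subst (λ k → 2 + k ≤ level p) (level-north x y) far
    low₁ : ∀ {q} → level q ≡ 1 + (x + y) → p ≢ q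
    low₁ q≡ = level-≢ (2 + (x + y)) (≤-trans (≤-reflexive q≡) (n≤1+n _)) far′
    low₂ : ∀ {q} → level q ≡ 2 + (x + y) → p ≢ q
    low₂ q≡ = level-≢ (2 + (x + y)) (≤-reflexive q≡) far′

module EastStep (x y : ℕ) (n e s : Bool) (f : Point → ℕ) where

  g : Point → ℕ
  g = withEdgeIf s (S (suc x , y)) (withEdgeIf e (E (x , y)) (withEdgeIf n (N (x , y)) f))

  private
    fN = withEdgeIf n (N (x , y)) f
    fNE = withEdgeIf e (E (x , y)) fN
    skip : ∀ v → v ≢ (suc x , y) → v ≢ (suc (suc x) , y) → v ≢ (suc x , suc y) → v ≢ (x , suc y) → g v ≡ f v
    skip v a b c d = trans (withEdgeIf-∉ s (S (suc x , y)) fNE v (elemP-≢ v (suc x , y) (suc (suc x) , y) a b))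
                    (trans (withEdgeIf-∉ e (E (x , y)) fN v (elemP-≢ v (suc x , y) (suc x , suc y) a c))
                           (withEdgeIf-∉ n (N (x , y)) f v (elemP-≢ v (x , suc y) (suc x , suc y) d c)))

  at-SW : g (x , y) ≡ f (x , y)
  at-SW = skip (x , y) (<ˣ⇒≢ ≤-refl) (<ˣ⇒≢ (n≤1+n (suc x))) (<ˣ⇒≢ ≤-refl) (<ʸ⇒≢ ≤-refl)

  at-NW : g (x , suc y) ≡ toℕ n + f (x , suc y)
  at-NW = trans (withEdgeIf-∉ s (S (suc x , y)) fNE (x , suc y) (elemP-≢ (x , suc y) (suc x , y) (suc (suc x) , y) (<ˣ⇒≢ ≤-refl) (<ˣ⇒≢ (n≤1+n (suc x)))))
         (trans (withEdgeIf-∉ e (E (x , y)) fN (x , suc y) (elemP-≢ (x , suc y) (suc x , y) (suc x , suc y) (<ˣ⇒≢ ≤-refl) (<ˣ⇒≢ ≤-refl)))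
                (withEdgeIf-∈ n (N (x , y)) f (x , suc y) (elemP-here (x , suc y) (suc x , suc y))))

  at-SW′ : g (suc x , y) ≡ toℕ s + (toℕ e + f (suc x , y))
  at-SW′ = trans (withEdgeIf-∈ s (S (suc x , y)) fNE (suc x , y) (elemP-here (suc x , y) (suc (suc x) , y)))
          (cong (toℕ s +_) (trans (withEdgeIf-∈ e (E (x , y)) fN (suc x , y) (elemP-here (suc x , y) (suc x , suc y)))
            (cong (toℕ e +_) (withEdgeIf-∉ n (N (x , y)) f (suc x , y) (elemP-≢ (suc x , y) (x , suc y) (suc x , suc y) (>ˣ⇒≢ ≤-refl) (<ʸ⇒≢ ≤-refl))))))

  at-NW′ : g (suc x , suc y) ≡ toℕ e + (toℕ n + f (suc x , suc y))
  at-NW′ = trans (withEdgeIf-∉ s (S (suc x , y)) fNE (suc x , suc y) (elemP-≢ (suc x , suc y) (suc x , y) (suc (suc x) , y) (>ʸ⇒≢ ≤-refl) (<ˣ⇒≢ ≤-refl)))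
          (trans (withEdgeIf-∈ e (E (x , y)) fN (suc x , suc y) (elemP-there (suc x , suc y) (suc x , y) (>ʸ⇒≢ ≤-refl)))
                 (cong (toℕ e +_) (withEdgeIf-∈ n (N (x , y)) f (suc x , suc y) (elemP-there (suc x , suc y) (x , suc y) (>ˣ⇒≢ ≤-refl)))))

  at-SE′ : g (suc (suc x) , y) ≡ toℕ s + f (suc (suc x) , y)
  at-SE′ = trans (withEdgeIf-∈ s (S (suc x , y)) fNE (suc (suc x) , y) (elemP-there (suc (suc x) , y) (suc x , y) (>ˣ⇒≢ ≤-refl)))
          (cong (toℕ s +_) (skipNE (>ˣ⇒≢ ≤-refl) (>ˣ⇒≢ (n≤1+n (suc x))) (>ˣ⇒≢ ≤-refl)))
    where
    skipNE : ∀ {v} → v ≢ (suc x , y) → v ≢ (x , suc y) → v ≢ (suc x , suc y) → fNE v ≡ f v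
    skipNE {v} a d c = trans (withEdgeIf-∉ e (E (x , y)) fN v (elemP-≢ v (suc x , y) (suc x , suc y) a c))
                             (withEdgeIf-∉ n (N (x , y)) f v (elemP-≢ v (x , suc y) (suc x , suc y) d c))

  vanishes : Vanishes f (2 + (x + y)) → Vanishes g (2 + level (suc x , y))
  vanishes f-vanishes p far =
    trans (skip p (low₁ refl) (low₂ refl) (low₂ (level-northeast x y)) (low₁ (level-north x y)))
          (f-vanishes p (≤-trans (n≤1+n _) far))
    where
    low₁ : ∀ {q} → level q ≡ 1 + (x + y) → p ≢ q
    low₁ q≡ = level-≢ (2 + (x + y)) (≤-trans (≤-reflexive q≡) (n≤1+n _)) far
    low₂ : ∀ {q} → level q ≡ 2 + (x + y) → p ≢ q
    low₂ q≡ = level-≢ (2 + (x + y)) (≤-reflexive q≡) far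

data Constraint : Set where
  free avoidN avoidE : Constraint

satisfies : Constraint → Tile → List Edge → Bool
satisfies free t M = true
satisfies avoidN t M = not (elemE (N t) M)
satisfies avoidE t M = not (elemE (E t) M)

satisfies-∷ : ∀ m t e M → eqE (N t) e ≡ false → eqE (E t) e ≡ false → satisfies m t (e ∷ M) ≡ satisfies m t M
satisfies-∷ free t e M N≢e E≢e = refl
satisfies-∷ avoidN t e M N≢e E≢e rewrite N≢e = refl
satisfies-∷ avoidE t e M N≢e E≢e rewrite E≢e = refl

satisfies-consIf : ∀ b m t e M → eqE (N t) e ≡ false → eqE (E t) e ≡ false →
  satisfies m t (consIf b e M) ≡ satisfies m t M
satisfies-consIf true m t e M N≢e E≢e = satisfies-∷ m t e M N≢e E≢e
satisfies-consIf false m t e M N≢e E≢e = refl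

allowed : Constraint → Bool → Bool → Bool
allowed free n e = true
allowed avoidN n e = not n
allowed avoidE n e = not e

satisfies-lastTile : ∀ t m n e → satisfies m t (consIf n (N t) (consIf e (E t) [])) ≡ allowed m n e
satisfies-lastTile t free n e = refl
satisfies-lastTile t avoidN true e rewrite eqE-refl (N t) = refl
satisfies-lastTile t avoidN false true = refl
satisfies-lastTile t avoidN false false = refl
satisfies-lastTile t avoidE true true rewrite eqE-refl (E t) = refl
satisfies-lastTile t avoidE true false = refl
satisfies-lastTile t avoidE false true rewrite eqE-refl (E t) = refl
satisfies-lastTile t avoidE false false = refl

lastTileFrom-≽ : ∀ t ds → t ≼ lastTileFrom t ds
lastTileFrom-≽ t [] = ≼-refl t
lastTileFrom-≽ (x , y) (nor ∷ ds) = ≼-trans (x , y) (x , suc y) _ (≤-refl , n≤1+n y) (lastTileFrom-≽ (x , suc y) ds)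
lastTileFrom-≽ (x , y) (eas ∷ ds) = ≼-trans (x , y) (suc x , y) _ (n≤1+n x , ≤-refl) (lastTileFrom-≽ (suc x , y) ds)

-- transfer ds a b c m counts the sublists of laterEdges t ds that complete partial degrees
-- a, b, c at the corners SW, NW, SE of t to a perfect matching and satisfy m on the last tile.
-- The summation variables are the choices of N t, E t and the remaining new edge of the next tile.
transfer : List Dir → ℕ → ℕ → ℕ → Constraint → ℕ
transfer [] a b c m = sum² λ n e →
  toℕ (allB (_≡ᵇ 1) (a ∷ toℕ e + c ∷ toℕ n + b ∷ toℕ e + toℕ n ∷ []) ∧ allowed m n e)
transfer (nor ∷ ds) a b c m = sum³ λ n e w →
  if (a ≡ᵇ 1) ∧ (toℕ e + c ≡ᵇ 1) then transfer ds (toℕ w + (toℕ n + b)) (toℕ w) (toℕ e + toℕ n) m else 0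
transfer (eas ∷ ds) a b c m = sum³ λ n e s →
  if (a ≡ᵇ 1) ∧ (toℕ n + b ≡ᵇ 1) then transfer ds (toℕ s + (toℕ e + c)) (toℕ e + toℕ n) (toℕ s) m else 0

completesWith : (Point → ℕ) → Constraint → Tile → List Dir → List Edge → Bool
completesWith f m t ds M = completes f (snakeCorners t ds) M ∧ satisfies m (lastTileFrom t ds) M

+-vanish : ∀ a {b} → b ≡ 0 → a + b ≡ a
+-vanish a refl = +-identityʳ a

level-far : ∀ x y → 2 + (x + y) ≤ level (suc x , suc y)
level-far x y = ≤-reflexive (sym (level-northeast x y))

CountedByTransfer : List Dir → ℕ → ℕ → Constraint → Set
CountedByTransfer ds x y m = ∀ f → Vanishes f (2 + (x + y)) →
  countSublists (completesWith f m (x , y) ds) (laterEdges (x , y) ds)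
  ≡ transfer ds (f (x , y)) (f (x , suc y)) (f (suc x , y)) m

transfer-[] : ∀ x y m → CountedByTransfer [] x y m
transfer-[] x y m f f-vanishes =
  trans (countSublists-∷² (completesWith f m (x , y) []) (N (x , y)) (E (x , y)) [])
        (sum²-cong term)
  where
  open NorthStep x y
  term : ∀ n e →
    countSublists (λ M → completesWith f m (x , y) [] (consIf n (N (x , y)) (consIf e (E (x , y)) M))) []
    ≡ toℕ (allB (_≡ᵇ 1) (f (x , y) ∷ toℕ e + f (suc x , y) ∷ toℕ n + f (x , suc y) ∷ toℕ e + toℕ n ∷ []) ∧ allowed m n e)
  term n e = trans (countSublists-[] (λ M → completesWith f m (x , y) [] (consIf n (N (x , y)) (consIf e (E (x , y)) M))))
                   (cong toℕ (cong₂ _∧_ degrees (satisfies-lastTile (x , y) m n e)))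
    where
    degrees : completes f (snakeCorners (x , y) []) (consIf n (N (x , y)) (consIf e (E (x , y)) []))
            ≡ allB (_≡ᵇ 1) (f (x , y) ∷ toℕ e + f (suc x , y) ∷ toℕ n + f (x , suc y) ∷ toℕ e + toℕ n ∷ [])
    degrees = begin
      completes f (snakeCorners (x , y) []) (consIf n (N (x , y)) (consIf e (E (x , y)) []))
        ≡⟨ completes-consIf n f (snakeCorners (x , y) []) (N (x , y)) (consIf e (E (x , y)) []) ⟩
      completes (withEdgeIf n (N (x , y)) f) (snakeCorners (x , y) []) (consIf e (E (x , y)) [])
        ≡⟨ completes-consIf e (withEdgeIf n (N (x , y)) f) (snakeCorners (x , y) []) (E (x , y)) [] ⟩
      completes (g n e false f) (snakeCorners (x , y) []) []
        ≡⟨ completes-[] (g n e false f) (snakeCorners (x , y) []) ⟩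
      allB (λ v → g n e false f v ≡ᵇ 1) (corners (x , y))
        ≡⟨ cong (allB (_≡ᵇ 1)) (cong₂ _∷_ (at-SW n e false f) (cong₂ _∷_ (at-SE n e false f)
             (cong₂ _∷_ (at-SW′ n e false f) (cong (_∷ []) NE≡)))) ⟩
      allB (_≡ᵇ 1) (f (x , y) ∷ toℕ e + f (suc x , y) ∷ toℕ n + f (x , suc y) ∷ toℕ e + toℕ n ∷ []) ∎
      where
      open ≡-Reasoning
      NE≡ : g n e false f (suc x , suc y) ≡ toℕ e + toℕ n
      NE≡ = trans (at-SE′ n e false f) (cong (toℕ e +_) (+-vanish (toℕ n) (f-vanishes _ (level-far x y))))

transfer-nor : ∀ ds x y m → CountedByTransfer ds x (suc y) m → CountedByTransfer (nor ∷ ds) x y m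
transfer-nor ds x y m IH f f-vanishes =
  trans (countSublists-∷³ (completesWith f m t (nor ∷ ds)) (N t) (E t) (W t′) later) (sum³-cong term)
  where
  open NorthStep x y
  t t′ : Tile
  t = x , y
  t′ = x , suc y
  later = laterEdges t′ ds
  last = lastTileFrom t′ ds
  t′≼last = lastTileFrom-≽ t′ ds
  N≢N : eqE (N last) (N t) ≡ false
  N≢N = eqE-≢ (N last) (N t) (>ʸ⇒≢ (s≤s (proj₂ t′≼last)))
  E≢E : eqE (E last) (E t) ≡ false
  E≢E = eqE-≢ (E last) (E t) (>ʸ⇒≢ (proj₂ t′≼last))
  E≢W : eqE (E last) (W t′) ≡ false
  E≢W = eqE-≢ (E last) (W t′) (>ˣ⇒≢ (s≤s (proj₁ t′≼last)))
  term : ∀ n e w →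
    countSublists (λ M → completesWith f m t (nor ∷ ds) (consIf n (N t) (consIf e (E t) (consIf w (W t′) M)))) later
    ≡ (if (f t ≡ᵇ 1) ∧ (toℕ e + f (suc x , y) ≡ᵇ 1)
       then transfer ds (toℕ w + (toℕ n + f (x , suc y))) (toℕ w) (toℕ e + toℕ n) m else 0)
  term n e w =
    begin
      countSublists (λ M → completesWith f m t (nor ∷ ds) (consIf n (N t) (consIf e (E t) (consIf w (W t′) M)))) later
        ≡⟨ countSublists-cong (After t′) _ (λ M → lower ∧ completesWith g′ m t′ ds M) later
             (All.map proj₁ (laterEdges-strictlyAfter t′ ds)) split ⟩
      countSublists (λ M → lower ∧ completesWith g′ m t′ ds M) later
        ≡⟨ countSublists-∧ˡ lower (completesWith g′ m t′ ds) later ⟩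
      (if lower then countSublists (completesWith g′ m t′ ds) later else 0)
        ≡⟨ cong₂ (λ c k → if c then k else 0)
             (cong₂ (λ p q → (p ≡ᵇ 1) ∧ (q ≡ᵇ 1)) (at-SW n e w f) (at-SE n e w f))
             (trans (IH g′ (vanishes n e w f f-vanishes)) args) ⟩
      (if (f t ≡ᵇ 1) ∧ (toℕ e + f (suc x , y) ≡ᵇ 1)
       then transfer ds (toℕ w + (toℕ n + f (x , suc y))) (toℕ w) (toℕ e + toℕ n) m else 0) ∎
    where
    open ≡-Reasoning
    g′ = g n e w f
    lower = (g′ (x , y) ≡ᵇ 1) ∧ (g′ (suc x , y) ≡ᵇ 1)
    V = snakeCorners t (nor ∷ ds)
    split : ∀ M → All (After t′) M →
      completesWith f m t (nor ∷ ds) (consIf n (N t) (consIf e (E t) (consIf w (W t′) M)))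
      ≡ lower ∧ completesWith g′ m t′ ds M
    split M after = trans (cong₂ _∧_
      (trans (completes-consIf n f V (N t) _) (trans (completes-consIf e _ V (E t) _)
        (trans (completes-consIf w _ V (W t′) M) (completes-nor x y ds g′ M after))))
      (trans (satisfies-consIf n m last (N t) _ N≢N refl) (trans (satisfies-consIf e m last (E t) _ refl E≢E)
        (satisfies-consIf w m last (W t′) M refl E≢W))))
      (∧-assoc lower _ _)
    args : transfer ds (g′ (x , suc y)) (g′ (x , suc (suc y))) (g′ (suc x , suc y)) m
         ≡ transfer ds (toℕ w + (toℕ n + f (x , suc y))) (toℕ w) (toℕ e + toℕ n) m
    args = cong₂ (λ a bc → transfer ds a (proj₁ bc) (proj₂ bc) m) (at-SW′ n e w f) (cong₂ _,_
             (trans (at-NW′ n e w f) (+-vanish (toℕ w) (f-vanishes _ (≤-reflexive (sym (level-north² x y))))))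
             (trans (at-SE′ n e w f) (cong (toℕ e +_) (+-vanish (toℕ n) (f-vanishes _ (level-far x y))))))
transfer-eas : ∀ ds x y m → CountedByTransfer ds (suc x) y m → CountedByTransfer (eas ∷ ds) x y m
transfer-eas ds x y m IH f f-vanishes =
  trans (countSublists-∷³ (completesWith f m t (eas ∷ ds)) (N t) (E t) (S t′) later) (sum³-cong term)
  where
  open EastStep x y
  t t′ : Tile
  t = x , y
  t′ = suc x , y
  later = laterEdges t′ ds
  last = lastTileFrom t′ ds
  t′≼last = lastTileFrom-≽ t′ ds
  N≢N : eqE (N last) (N t) ≡ false
  N≢N = eqE-≢ (N last) (N t) (>ˣ⇒≢ (proj₁ t′≼last))
  E≢E : eqE (E last) (E t) ≡ false
  E≢E = eqE-≢ (E last) (E t) (>ˣ⇒≢ (s≤s (proj₁ t′≼last)))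
  N≢S : eqE (N last) (S t′) ≡ false
  N≢S = eqE-≢ (N last) (S t′) (>ʸ⇒≢ (s≤s (proj₂ t′≼last)))
  term : ∀ n e s →
    countSublists (λ M → completesWith f m t (eas ∷ ds) (consIf n (N t) (consIf e (E t) (consIf s (S t′) M)))) later
    ≡ (if (f t ≡ᵇ 1) ∧ (toℕ n + f (x , suc y) ≡ᵇ 1)
       then transfer ds (toℕ s + (toℕ e + f (suc x , y))) (toℕ e + toℕ n) (toℕ s) m else 0)
  term n e s =
    begin
      countSublists (λ M → completesWith f m t (eas ∷ ds) (consIf n (N t) (consIf e (E t) (consIf s (S t′) M)))) later
        ≡⟨ countSublists-cong (After t′) _ (λ M → lower ∧ completesWith g′ m t′ ds M) later
             (All.map proj₁ (laterEdges-strictlyAfter t′ ds)) split ⟩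
      countSublists (λ M → lower ∧ completesWith g′ m t′ ds M) later
        ≡⟨ countSublists-∧ˡ lower (completesWith g′ m t′ ds) later ⟩
      (if lower then countSublists (completesWith g′ m t′ ds) later else 0)
        ≡⟨ cong₂ (λ c k → if c then k else 0)
             (cong₂ (λ p q → (p ≡ᵇ 1) ∧ (q ≡ᵇ 1)) (at-SW n e s f) (at-NW n e s f))
             (trans (IH g′ (vanishes n e s f f-vanishes)) args) ⟩
      (if (f t ≡ᵇ 1) ∧ (toℕ n + f (x , suc y) ≡ᵇ 1)
       then transfer ds (toℕ s + (toℕ e + f (suc x , y))) (toℕ e + toℕ n) (toℕ s) m else 0) ∎
    where
    open ≡-Reasoning
    g′ = g n e s f
    lower = (g′ (x , y) ≡ᵇ 1) ∧ (g′ (x , suc y) ≡ᵇ 1)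
    V = snakeCorners t (eas ∷ ds)
    split : ∀ M → All (After t′) M →
      completesWith f m t (eas ∷ ds) (consIf n (N t) (consIf e (E t) (consIf s (S t′) M)))
      ≡ lower ∧ completesWith g′ m t′ ds M
    split M after = trans (cong₂ _∧_
      (trans (completes-consIf n f V (N t) _) (trans (completes-consIf e _ V (E t) _)
        (trans (completes-consIf s _ V (S t′) M) (completes-eas x y ds g′ M after))))
      (trans (satisfies-consIf n m last (N t) _ N≢N refl) (trans (satisfies-consIf e m last (E t) _ refl E≢E)
        (satisfies-consIf s m last (S t′) M N≢S refl))))
      (∧-assoc lower _ _)
    args : transfer ds (g′ (suc x , y)) (g′ (suc x , suc y)) (g′ (suc (suc x) , y)) m
         ≡ transfer ds (toℕ s + (toℕ e + f (suc x , y))) (toℕ e + toℕ n) (toℕ s) m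
    args = cong₂ (λ a bc → transfer ds a (proj₁ bc) (proj₂ bc) m) (at-SW′ n e s f) (cong₂ _,_
             (trans (at-NW′ n e s f) (cong (toℕ e +_) (+-vanish (toℕ n) (f-vanishes _ (level-far x y)))))
             (trans (at-SE′ n e s f) (+-vanish (toℕ s) (f-vanishes _ ≤-refl))))

countSublists-transfer : ∀ ds x y m → CountedByTransfer ds x y m
countSublists-transfer [] x y m = transfer-[] x y m
countSublists-transfer (nor ∷ ds) x y m = transfer-nor ds x y m (countSublists-transfer ds x (suc y) m)
countSublists-transfer (eas ∷ ds) x y m = transfer-eas ds x y m (countSublists-transfer ds (suc x) y m)

transfer-unmatched : ∀ ds a b c m → (a ≡ᵇ 1) ≡ false → transfer ds a b c m ≡ 0
transfer-unmatched [] a b c m a≢1 rewrite a≢1 = refl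
transfer-unmatched (nor ∷ ds) a b c m a≢1 rewrite a≢1 = refl
transfer-unmatched (eas ∷ ds) a b c m a≢1 rewrite a≢1 = refl

-- Counts for the part of the snake after S(G₁) (resp. W(G₁)) has been put into the matching.
throughS throughW : Constraint → List Dir → ℕ
throughS m ds = transfer ds 1 0 1 m
throughW m ds = transfer ds 1 1 0 m

throughS-nor : ∀ m ds → throughS m (nor ∷ ds) ≡ throughS m ds + throughW m ds
throughS-nor m ds rewrite transfer-unmatched ds 0 0 0 m refl | transfer-unmatched ds 2 1 1 m refl =
  cong (throughS m ds +_) (+-identityʳ _)

throughW-nor : ∀ m ds → throughW m (nor ∷ ds) ≡ throughS m ds
throughW-nor m ds rewrite transfer-unmatched ds 2 0 2 m refl | transfer-unmatched ds 2 1 1 m refl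
                        | transfer-unmatched ds 3 1 2 m refl = +-identityʳ _

throughS-eas : ∀ m ds → throughS m (eas ∷ ds) ≡ throughW m ds
throughS-eas m ds rewrite transfer-unmatched ds 2 1 1 m refl | transfer-unmatched ds 2 2 0 m refl
                        | transfer-unmatched ds 3 2 1 m refl = +-identityʳ _

throughW-eas : ∀ m ds → throughW m (eas ∷ ds) ≡ throughS m ds + throughW m ds
throughW-eas m ds rewrite transfer-unmatched ds 0 0 0 m refl | transfer-unmatched ds 2 1 1 m refl =
  trans (cong (throughW m ds +_) (+-identityʳ _)) (+-comm (throughW m ds) _)

through : FirstEdge → Constraint → List Dir → ℕ
through south = throughS
through west = throughW

degree-origin : ∀ M → All (StrictlyAfter (0 , 0)) M → degree M (0 , 0) ≡ 0
degree-origin [] [] = refl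
degree-origin (hor a b ∷ M) ((_ , ne) ∷ after)
  rewrite elemP-≢ (0 , 0) (a , b) (suc a , b) (λ eq → ne (sym eq)) (λ ()) = degree-origin M after
degree-origin (ver a b ∷ M) ((_ , ne) ∷ after)
  rewrite elemP-≢ (0 , 0) (a , b) (a , suc b) (λ eq → ne (sym eq)) (λ ()) = degree-origin M after

completes-origin : ∀ f G M → (f (0 , 0) + degree M (0 , 0) ≡ᵇ 1) ≡ false →
  completes f (snakeCorners (0 , 0) G) M ≡ false
completes-origin f G M bad with allB-snakeCorners 0 0 G (λ v → f v + degree M v ≡ᵇ 1)
... | _ , eq rewrite bad = eq

-- A perfect matching of G contains exactly one of S(G₁) and W(G₁), as they share the corner (0 , 0).
countSublists-firstTile : ∀ G (Q : List Edge → Bool) →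
  countSublists (λ M → completes noDegrees (snakeCorners (0 , 0) G) M ∧ Q M) (S (0 , 0) ∷ W (0 , 0) ∷ laterEdges (0 , 0) G)
  ≡ countSublists (λ M → completes noDegrees (snakeCorners (0 , 0) G) (S (0 , 0) ∷ M) ∧ Q (S (0 , 0) ∷ M)) (laterEdges (0 , 0) G)
  + countSublists (λ M → completes noDegrees (snakeCorners (0 , 0) G) (W (0 , 0) ∷ M) ∧ Q (W (0 , 0) ∷ M)) (laterEdges (0 , 0) G)
countSublists-firstTile G Q =
  trans (countSublists-∷² P (S (0 , 0)) (W (0 , 0)) later)
        (cong₂ _+_ (cong (_+ viaS) (countSublists-zero (StrictlyAfter (0 , 0)) _ later after (λ M _ → both M)))
                   (trans (cong (viaW +_) (countSublists-zero (StrictlyAfter (0 , 0)) P later after neither)) (+-identityʳ viaW)))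
  where
  V = snakeCorners (0 , 0) G
  later = laterEdges (0 , 0) G
  after = laterEdges-strictlyAfter (0 , 0) G
  P : List Edge → Bool
  P M = completes noDegrees V M ∧ Q M
  viaS = countSublists (λ M → P (S (0 , 0) ∷ M)) later
  viaW = countSublists (λ M → P (W (0 , 0) ∷ M)) later
  both : ∀ M → P (S (0 , 0) ∷ W (0 , 0) ∷ M) ≡ false
  both M = cong (_∧ _) (completes-origin noDegrees G (S (0 , 0) ∷ W (0 , 0) ∷ M) refl)
  neither : ∀ M → All (StrictlyAfter (0 , 0)) M → P M ≡ false
  neither M after-M = cong (_∧ Q M) (completes-origin noDegrees G M (cong (_≡ᵇ 1) (degree-origin M after-M)))

vanishes-firstEdge : ∀ G c → Vanishes (withEdge noDegrees (firstEdge G c)) 2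
vanishes-firstEdge G south p far =
  withEdgeIf-∉ true (S (0 , 0)) noDegrees p (elemP-≢ p (0 , 0) (1 , 0) (level-≢ 1 z≤n far) (level-≢ 1 ≤-refl far))
vanishes-firstEdge G west p far =
  withEdgeIf-∉ true (W (0 , 0)) noDegrees p (elemP-≢ p (0 , 0) (0 , 1) (level-≢ 1 z≤n far) (level-≢ 1 ≤-refl far))

countSublists-through : ∀ G c m (Q : List Edge → Bool) →
  (∀ M → All (StrictlyAfter (0 , 0)) M → Q (firstEdge G c ∷ M) ≡ satisfies m (lastTile G) M) →
  countSublists (λ M → completes noDegrees (snakeCorners (0 , 0) G) (firstEdge G c ∷ M) ∧ Q (firstEdge G c ∷ M))
                (laterEdges (0 , 0) G)
  ≡ through c m G
countSublists-through G c m Q Q≡satisfies =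
  trans (countSublists-cong (StrictlyAfter (0 , 0)) _ (completesWith (withEdge noDegrees (firstEdge G c)) m (0 , 0) G)
          (laterEdges (0 , 0) G) (laterEdges-strictlyAfter (0 , 0) G)
          (λ M after → cong₂ _∧_ (completes-∷ noDegrees (snakeCorners (0 , 0) G) (firstEdge G c) M) (Q≡satisfies M after)))
        (trans (countSublists-transfer G 0 0 m (withEdge noDegrees (firstEdge G c)) (vanishes-firstEdge G c))
               (initial c))
  where
  initial : ∀ c → let f = withEdge noDegrees (firstEdge G c) in
    transfer G (f (0 , 0)) (f (0 , 1)) (f (1 , 0)) m ≡ through c m G
  initial south = refl
  initial west = refl

perfectMatchings-count : ∀ G → countSublists (isPerfectMatching G) (edges G) ≡ throughS free G + throughW free G
perfectMatchings-count G rewrite edges≡ G =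
  trans (countSublists-ext _ (λ M → completes noDegrees (snakeCorners (0 , 0) G) M ∧ true)
          (S (0 , 0) ∷ W (0 , 0) ∷ laterEdges (0 , 0) G)
          (λ M → trans (isPerfectMatching≡completes G M) (sym (∧-identityʳ _))))
  (trans (countSublists-firstTile G (λ _ → true))
         (cong₂ _+_ (countSublists-through G south free (λ _ → true) (λ _ _ → refl))
                    (countSublists-through G west free (λ _ → true) (λ _ _ → refl))))

avoids : Snake → FirstEdge → LastEdge → List Edge → Bool
avoids G c c′ M = not (elemE (firstEdge G c) M ∨ elemE (lastEdge G c′) M)

constraintOf : LastEdge → Constraint
constraintOf north = avoidN
constraintOf east = avoidE

lastEdge-≢-firstEdge : ∀ G c c′ → eqE (lastEdge G c′) (firstEdge G c) ≡ false
lastEdge-≢-firstEdge G south north = eqE-≢ (lastEdge G north) (S (0 , 0)) (>ʸ⇒≢ (s≤s z≤n))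
lastEdge-≢-firstEdge G south east = refl
lastEdge-≢-firstEdge G west north = refl
lastEdge-≢-firstEdge G west east = eqE-≢ (lastEdge G east) (W (0 , 0)) (>ˣ⇒≢ (s≤s z≤n))

firstEdge-fresh : ∀ G c M → All (StrictlyAfter (0 , 0)) M → elemE (firstEdge G c) M ≡ false
firstEdge-fresh G c M after =
  elemE-fresh (firstEdge G c) M (All.map (λ {e} (_ , ne) → eqE-≢ (firstEdge G c) e (λ eq → ne (trans (sym eq) (anchor-first c)))) after)
  where
  anchor-first : ∀ c → anchor (firstEdge G c) ≡ (0 , 0)
  anchor-first south = refl
  anchor-first west = refl

avoids-other : ∀ G c c′ M → All (StrictlyAfter (0 , 0)) M →
  avoids G c c′ (firstEdge G (otherFirst c) ∷ M) ≡ satisfies (constraintOf c′) (lastTile G) M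
avoids-other G c c′ M after = trans
  (cong not (cong₂ _∨_ (trans (cong (_∨ elemE (firstEdge G c) M) (other≢ c)) (firstEdge-fresh G c M after))
                       (cong (_∨ elemE (lastEdge G c′) M) (lastEdge-≢-firstEdge G (otherFirst c) c′))))
  (byLastEdge c′)
  where
  other≢ : ∀ c → eqE (firstEdge G c) (firstEdge G (otherFirst c)) ≡ false
  other≢ south = refl
  other≢ west = refl
  byLastEdge : ∀ c′ → not (elemE (lastEdge G c′) M) ≡ satisfies (constraintOf c′) (lastTile G) M
  byLastEdge north = refl
  byLastEdge east = refl

-- The perfect matchings containing neither e nor e′ contain the other edge of the first tile,
-- and are counted by the transfer recursion that forbids e′ on the last tile.
avoidingMatchings-count : ∀ G c c′ →
  countSublists (λ M → isPerfectMatching G M ∧ avoids G c c′ M) (edges G) ≡ through (otherFirst c) (constraintOf c′) G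
avoidingMatchings-count G c c′ rewrite edges≡ G =
  trans (countSublists-ext _ (λ M → completes noDegrees (snakeCorners (0 , 0) G) M ∧ avoids G c c′ M)
          (S (0 , 0) ∷ W (0 , 0) ∷ laterEdges (0 , 0) G)
          (λ M → cong (_∧ avoids G c c′ M) (isPerfectMatching≡completes G M)))
  (trans (countSublists-firstTile G (avoids G c c′)) (byFirstEdge c))
  where
  later = laterEdges (0 , 0) G
  after = laterEdges-strictlyAfter (0 , 0) G
  containing : FirstEdge → Edge → ℕ
  containing c e = countSublists (λ M → completes noDegrees (snakeCorners (0 , 0) G) (e ∷ M) ∧ avoids G c c′ (e ∷ M)) later
  excluded : ∀ c M → avoids G c c′ (firstEdge G c ∷ M) ≡ false
  excluded south M = refl
  excluded west M = refl
  none : ∀ c → containing c (firstEdge G c) ≡ 0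
  none c = countSublists-zero (StrictlyAfter (0 , 0)) _ later after
             (λ M _ → trans (cong (_ ∧_) (excluded c M)) (∧-zeroʳ _))
  other : ∀ c → containing c (firstEdge G (otherFirst c)) ≡ through (otherFirst c) (constraintOf c′) G
  other c = countSublists-through G (otherFirst c) (constraintOf c′) (avoids G c c′) (avoids-other G c c′)
  byFirstEdge : ∀ c → containing c (S (0 , 0)) + containing c (W (0 , 0)) ≡ through (otherFirst c) (constraintOf c′) G
  byFirstEdge south = trans (cong (_+ containing south (W (0 , 0))) (none south)) (other south)
  byFirstEdge west = trans (cong₂ _+_ (other west) (none west)) (+-identityʳ _)

-- Continued fractions of the sign blocks

contPair-coprime : ∀ L → gcd (proj₁ (contPair L)) (proj₂ (contPair L)) ≡ 1
contPair-coprime [] = refl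
contPair-coprime (b ∷ L) = ∣1⇒≡1 (subst (gcd (b * p + q) p ∣_) (contPair-coprime L)
  (gcd-greatest (gcd[m,n]∣n (b * p + q) p)
                (∣m+n∣m⇒∣n (gcd[m,n]∣m (b * p + q) p) (∣-trans (gcd[m,n]∣n (b * p + q) p) (n∣m*n b)))))
  where
  p = proj₁ (contPair L)
  q = proj₂ (contPair L)

cfNum≡numerator : ∀ L → cfNum L ≡ proj₁ (contPair L)
cfNum≡numerator L rewrite contPair-coprime L = n/1≡n _

denominator-∷ : ∀ a L → proj₂ (contPair (a ∷ L)) ≡ cfNum L
denominator-∷ a L = sym (cfNum≡numerator L)

numerator-∸-denominator : ∀ a L → 1 ≤ a → proj₁ (contPair (a ∷ L)) ∸ proj₂ (contPair (a ∷ L)) ≡ cfNum ((a ∸ 1) ∷ L)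
numerator-∸-denominator (suc a) L _ =
  trans (cong (_∸ p) (+-assoc p (a * p) q)) (trans (m+n∸m≡n p (a * p + q)) (sym (cfNum≡numerator ((suc a ∸ 1) ∷ L))))
  where
  p = proj₁ (contPair L)
  q = proj₂ (contPair L)

cfStep : ℕ → ℕ × ℕ → ℕ × ℕ
cfStep k pq = k * proj₁ pq + proj₂ pq , proj₁ pq

data LastBlock : Set where
  keep decrement drop : LastBlock

adjustBlock : LastBlock → ℕ → List ℕ
adjustBlock keep x = x ∷ []
adjustBlock decrement x = (x ∸ 1) ∷ []
adjustBlock drop x = []

adjustLast : LastBlock → List ℕ → List ℕ
adjustLast r [] = []
adjustLast r (x ∷ []) = adjustBlock r x
adjustLast r (x ∷ y ∷ xs) = x ∷ adjustLast r (y ∷ xs)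

adjustLast-keep : ∀ L → adjustLast keep L ≡ L
adjustLast-keep [] = refl
adjustLast-keep (x ∷ []) = refl
adjustLast-keep (x ∷ y ∷ L) = cong (x ∷_) (adjustLast-keep (y ∷ L))

adjustLast-decrement : ∀ x L y → adjustLast decrement (x ∷ L ++ y ∷ []) ≡ x ∷ L ++ (y ∸ 1) ∷ []
adjustLast-decrement x [] y = refl
adjustLast-decrement x (z ∷ L) y = cong (x ∷_) (adjustLast-decrement z L y)

adjustLast-drop : ∀ x L y → adjustLast drop (x ∷ L ++ y ∷ []) ≡ x ∷ L
adjustLast-drop x [] y = refl
adjustLast-drop x (z ∷ L) y = cong (x ∷_) (adjustLast-drop z L y)

blocksFrom-nonempty : ∀ x k xs → ∃[ b ] ∃[ bs ] blocksFrom x k xs ≡ b ∷ bs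
blocksFrom-nonempty x k [] = _ , _ , refl
blocksFrom-nonempty x k (y ∷ ys) with eqSign x y
... | true = blocksFrom-nonempty x (suc k) ys
... | false = _ , _ , refl

adjustLast-blocksFrom : ∀ r k x k′ xs → adjustLast r (k ∷ blocksFrom x k′ xs) ≡ k ∷ adjustLast r (blocksFrom x k′ xs)
adjustLast-blocksFrom r k x k′ xs with blocksFrom-nonempty x k′ xs
... | b , bs , eq rewrite eq = refl

-- The final values of the two arguments of signTail: the last sign emitted and the sign of S(G_d).
finalSigns : Sign → Sign → List Dir → Sign × Sign
finalSigns f s [] = f , s
finalSigns f s (nor ∷ ds) = finalSigns (neg s) (neg s) ds
finalSigns f s (eas ∷ ds) = finalSigns s (neg s) ds

-- Forbidding N or E of the last tile shortens the last block by one or removes it, depending on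
-- whether the sign sequence ends with the sign of that edge.
blockChange : Constraint → Sign × Sign → LastBlock
blockChange free _ = keep
blockChange avoidN (f , s) = if eqSign f s then drop else decrement
blockChange avoidE (f , s) = if eqSign f s then decrement else drop

orientedCounts : Sign → Sign → Constraint → List Dir → ℕ × ℕ
orientedCounts f s m ds = if eqSign f s then (throughS m ds , throughW m ds) else (throughW m ds , throughS m ds)

newBlock : ∀ k X Y → cfStep k (cfStep 1 (X , Y)) ≡ cfStep k (X + Y , X)
newBlock k X Y = cong (λ Z → cfStep k (Z + Y , X)) (*-identityˡ X)

newBlock′ : ∀ k X Y → cfStep k (cfStep 1 (X , Y)) ≡ cfStep k (Y + X , X)
newBlock′ k X Y = trans (newBlock k X Y) (cong (λ Z → cfStep k (Z , X)) (+-comm X Y))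

sameBlock : ∀ k X Y → cfStep (suc k) (X , Y) ≡ cfStep k (X , X + Y)
sameBlock k X Y = cong (_, X) (solve 3 (λ k X Y → (con 1 :+ k) :* X :+ Y := k :* X :+ (X :+ Y)) refl k X Y)
  where open +-*-Solver

sameBlock′ : ∀ k X Y → cfStep (suc k) (X , Y) ≡ cfStep k (X , Y + X)
sameBlock′ k X Y = trans (sameBlock k X Y) (cong (λ Z → cfStep k (X , Z)) (+-comm X Y))

singleBlock : ∀ k → suc k * 1 + 0 ≡ k * 1 + 1
singleBlock k = solve 1 (λ k → (con 1 :+ k) :* con 1 :+ con 0 := k :* con 1 :+ con 1) refl k
  where open +-*-Solver

-- The adjusted blocks of the rest of the sign sequence, with current block length k, form the
-- continued fraction k + Y/X where (X , Y) are the transfer counts ordered by the current sign pattern.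
contPair-blocks : ∀ ds f s k m →
  contPair (adjustLast (blockChange m (finalSigns f s ds)) (blocksFrom f k (signTail f s ds)))
  ≡ cfStep k (orientedCounts f s m ds)
contPair-blocks [] plus plus k free = cong (_, 1) (singleBlock k)
contPair-blocks [] plus plus k avoidN = cong (_, 0) (sym (cong (_+ 1) (*-zeroʳ k)))
contPair-blocks [] plus plus k avoidE = refl
contPair-blocks [] minus minus k free = cong (_, 1) (singleBlock k)
contPair-blocks [] minus minus k avoidN = cong (_, 0) (sym (cong (_+ 1) (*-zeroʳ k)))
contPair-blocks [] minus minus k avoidE = refl
contPair-blocks [] plus minus k free = cong (_, 1) (singleBlock k)
contPair-blocks [] plus minus k avoidN = refl
contPair-blocks [] plus minus k avoidE = cong (_, 0) (sym (cong (_+ 1) (*-zeroʳ k)))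
contPair-blocks [] minus plus k free = cong (_, 1) (singleBlock k)
contPair-blocks [] minus plus k avoidN = refl
contPair-blocks [] minus plus k avoidE = cong (_, 0) (sym (cong (_+ 1) (*-zeroʳ k)))
contPair-blocks (nor ∷ ds) minus minus k m
  rewrite adjustLast-blocksFrom (blockChange m (finalSigns plus plus ds)) k plus 1 (signTail plus plus ds)
        | contPair-blocks ds plus plus 1 m | throughS-nor m ds | throughW-nor m ds = newBlock k (throughS m ds) (throughW m ds)
contPair-blocks (nor ∷ ds) plus plus k m
  rewrite adjustLast-blocksFrom (blockChange m (finalSigns minus minus ds)) k minus 1 (signTail minus minus ds)
        | contPair-blocks ds minus minus 1 m | throughS-nor m ds | throughW-nor m ds = newBlock k (throughS m ds) (throughW m ds)
contPair-blocks (nor ∷ ds) minus plus k m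
  rewrite contPair-blocks ds minus minus (suc k) m | throughS-nor m ds | throughW-nor m ds = sameBlock k (throughS m ds) (throughW m ds)
contPair-blocks (nor ∷ ds) plus minus k m
  rewrite contPair-blocks ds plus plus (suc k) m | throughS-nor m ds | throughW-nor m ds = sameBlock k (throughS m ds) (throughW m ds)
contPair-blocks (eas ∷ ds) minus minus k m
  rewrite contPair-blocks ds minus plus (suc k) m | throughS-eas m ds | throughW-eas m ds = sameBlock′ k (throughW m ds) (throughS m ds)
contPair-blocks (eas ∷ ds) plus plus k m
  rewrite contPair-blocks ds plus minus (suc k) m | throughS-eas m ds | throughW-eas m ds = sameBlock′ k (throughW m ds) (throughS m ds)
contPair-blocks (eas ∷ ds) minus plus k m
  rewrite adjustLast-blocksFrom (blockChange m (finalSigns plus minus ds)) k plus 1 (signTail plus minus ds)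
        | contPair-blocks ds plus minus 1 m | throughS-eas m ds | throughW-eas m ds = newBlock′ k (throughW m ds) (throughS m ds)
contPair-blocks (eas ∷ ds) plus minus k m
  rewrite adjustLast-blocksFrom (blockChange m (finalSigns minus plus ds)) k minus 1 (signTail minus plus ds)
        | contPair-blocks ds minus plus 1 m | throughS-eas m ds | throughW-eas m ds = newBlock′ k (throughW m ds) (throughS m ds)

isOdd : ℕ → Bool
isOdd zero = false
isOdd (suc n) = not (isOdd n)

%2≡isOdd : ∀ n → n % 2 ≡ (if isOdd n then 1 else 0)
%2≡isOdd zero = refl
%2≡isOdd (suc zero) = refl
%2≡isOdd (suc (suc n)) rewrite not-involutive (isOdd n) = %2≡isOdd n

lastSign : Sign → List Sign → Sign
lastSign x [] = x
lastSign x (y ∷ ys) = lastSign y ys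

not-eqSign : ∀ y z → not (eqSign y z) ≡ eqSign (neg y) z
not-eqSign plus plus = refl
not-eqSign plus minus = refl
not-eqSign minus plus = refl
not-eqSign minus minus = refl

-- Consecutive blocks alternate in sign.
isOdd-#blocks : ∀ x k ys → isOdd (length (blocksFrom x k ys)) ≡ eqSign x (lastSign x ys)
isOdd-#blocks plus k [] = refl
isOdd-#blocks minus k [] = refl
isOdd-#blocks plus k (plus ∷ ys) = isOdd-#blocks plus (suc k) ys
isOdd-#blocks minus k (minus ∷ ys) = isOdd-#blocks minus (suc k) ys
isOdd-#blocks plus k (minus ∷ ys) = trans (cong not (isOdd-#blocks minus 1 ys)) (not-eqSign minus (lastSign minus ys))
isOdd-#blocks minus k (plus ∷ ys) = trans (cong not (isOdd-#blocks plus 1 ys)) (not-eqSign plus (lastSign plus ys))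

lastSign-signTail : ∀ x f s ds → lastSign x (signTail f s ds) ≡ proj₁ (finalSigns f s ds)
lastSign-signTail x f s [] = refl
lastSign-signTail x f s (nor ∷ ds) = lastSign-signTail (neg s) (neg s) (neg s) ds
lastSign-signTail x f s (eas ∷ ds) = lastSign-signTail s s (neg s) ds

-- The sign of S of the last tile.
lastSouthSign : Sign → List Dir → Sign
lastSouthSign s [] = s
lastSouthSign s (d ∷ ds) = lastSouthSign (neg s) ds

finalSigns-south : ∀ f s ds → proj₂ (finalSigns f s ds) ≡ lastSouthSign s ds
finalSigns-south f s [] = refl
finalSigns-south f s (nor ∷ ds) = finalSigns-south (neg s) (neg s) ds
finalSigns-south f s (eas ∷ ds) = finalSigns-south s (neg s) ds

blockList : Snake → List ℕ
blockList G = blocks (signSeq G)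

isOdd-#blockList : ∀ G → isOdd (length (blockList G)) ≡ eqSign minus (proj₁ (finalSigns minus minus G))
isOdd-#blockList G = trans (isOdd-#blocks minus 1 (signTail minus minus G)) (cong (eqSign minus) (lastSign-signTail minus minus minus G))

-- The minimal matching

-- The rest of the minimal matching from tile t on, where minus (plus) records that the
-- south (west) side of t is already covered.
minimalFrom : Tile → Sign → List Dir → List Edge
minimalFrom t minus [] = N t ∷ []
minimalFrom t plus [] = E t ∷ []
minimalFrom (x , y) minus (nor ∷ ds) = W (x , suc y) ∷ minimalFrom (x , suc y) plus ds
minimalFrom (x , y) minus (eas ∷ ds) = N (x , y) ∷ minimalFrom (suc x , y) plus ds
minimalFrom (x , y) plus (nor ∷ ds) = E (x , y) ∷ minimalFrom (x , suc y) minus ds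
minimalFrom (x , y) plus (eas ∷ ds) = S (suc x , y) ∷ minimalFrom (suc x , y) minus ds

⊆⇒∈sublists : ∀ {M es : List Edge} → M ⊆ es → M ∈ sublists es
⊆⇒∈sublists [] = here refl
⊆⇒∈sublists {es = e ∷ es} (.e ∷ʳ M⊆es) = ∈-++⁺ʳ (map (e ∷_) (sublists es)) (⊆⇒∈sublists M⊆es)
⊆⇒∈sublists (refl ∷ M⊆es) = ∈-++⁺ˡ (∈-map⁺ (_ ∷_) (⊆⇒∈sublists M⊆es))

minimalFrom-⊆ : ∀ t s ds → minimalFrom t s ds ⊆ laterEdges t ds
minimalFrom-⊆ t minus [] = refl ∷ (_ ∷ʳ [])
minimalFrom-⊆ t plus [] = _ ∷ʳ (refl ∷ [])
minimalFrom-⊆ (x , y) minus (nor ∷ ds) = _ ∷ʳ (_ ∷ʳ (refl ∷ minimalFrom-⊆ (x , suc y) plus ds))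
minimalFrom-⊆ (x , y) minus (eas ∷ ds) = refl ∷ (_ ∷ʳ (_ ∷ʳ minimalFrom-⊆ (suc x , y) plus ds))
minimalFrom-⊆ (x , y) plus (nor ∷ ds) = _ ∷ʳ (refl ∷ (_ ∷ʳ minimalFrom-⊆ (x , suc y) minus ds))
minimalFrom-⊆ (x , y) plus (eas ∷ ds) = _ ∷ʳ (_ ∷ʳ (refl ∷ minimalFrom-⊆ (suc x , y) minus ds))

minimalFrom-strictlyAfter : ∀ t s ds → All (StrictlyAfter t) (minimalFrom t s ds)
minimalFrom-strictlyAfter t s ds = All-resp-⊆ (minimalFrom-⊆ t s ds) (laterEdges-strictlyAfter t ds)

coveredW coveredS : Sign → ℕ
coveredW minus = 0
coveredW plus = 1
coveredS minus = 1
coveredS plus = 0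

bothOne : ∀ {a b} → a ≡ 1 → b ≡ 1 → ((a ≡ᵇ 1) ∧ (b ≡ᵇ 1)) ≡ true
bothOne refl refl = refl

allOne : ∀ (g : Point → ℕ) vs → All (λ v → g v ≡ 1) vs → allB (λ v → g v ≡ᵇ 1) vs ≡ true
allOne g [] [] = refl
allOne g (v ∷ vs) (gv≡1 ∷ ones) rewrite gv≡1 = allOne g vs ones

minimalFrom-completes : ∀ ds x y s f → Vanishes f (2 + (x + y)) →
  f (x , y) ≡ 1 → f (x , suc y) ≡ coveredW s → f (suc x , y) ≡ coveredS s →
  completes f (snakeCorners (x , y) ds) (minimalFrom (x , y) s ds) ≡ true
minimalFrom-completes [] x y minus f f-vanishes sw nw se =
  trans (completes-∷ f (snakeCorners (x , y) []) (N (x , y)) []) (trans (completes-[] g (corners (x , y)))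
    (allOne g (corners (x , y)) (trans at-SW sw ∷ trans at-SE se ∷ trans at-SW′ (cong suc nw)
                                 ∷ trans at-SE′ (cong suc (f-vanishes _ (level-far x y))) ∷ [])))
  where open NorthStep x y true false false f
minimalFrom-completes [] x y plus f f-vanishes sw nw se =
  trans (completes-∷ f (snakeCorners (x , y) []) (E (x , y)) []) (trans (completes-[] g (corners (x , y)))
    (allOne g (corners (x , y)) (trans at-SW sw ∷ trans at-SE (cong suc se) ∷ trans at-SW′ nw
                                 ∷ trans at-SE′ (cong suc (f-vanishes _ (level-far x y))) ∷ [])))
  where open NorthStep x y false true false f
minimalFrom-completes (nor ∷ ds) x y minus f f-vanishes sw nw se =
  trans (completes-∷ f (snakeCorners (x , y) (nor ∷ ds)) (W (x , suc y)) rest) (trans (completes-nor x y ds g rest after)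
    (cong₂ _∧_ (bothOne (trans at-SW sw) (trans at-SE se))
      (minimalFrom-completes ds x (suc y) plus g (vanishes f-vanishes) (trans at-SW′ (cong suc nw))
        (trans at-NW′ (cong suc (f-vanishes _ (≤-reflexive (sym (level-north² x y))))))
        (trans at-SE′ (f-vanishes _ (level-far x y))))))
  where
  open NorthStep x y false false true f
  rest = minimalFrom (x , suc y) plus ds
  after = All.map proj₁ (minimalFrom-strictlyAfter (x , suc y) plus ds)
minimalFrom-completes (nor ∷ ds) x y plus f f-vanishes sw nw se =
  trans (completes-∷ f (snakeCorners (x , y) (nor ∷ ds)) (E (x , y)) rest) (trans (completes-nor x y ds g rest after)
    (cong₂ _∧_ (bothOne (trans at-SW sw) (trans at-SE (cong suc se)))
      (minimalFrom-completes ds x (suc y) minus g (vanishes f-vanishes) (trans at-SW′ nw)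
        (trans at-NW′ (f-vanishes _ (≤-reflexive (sym (level-north² x y)))))
        (trans at-SE′ (cong suc (f-vanishes _ (level-far x y)))))))
  where
  open NorthStep x y false true false f
  rest = minimalFrom (x , suc y) minus ds
  after = All.map proj₁ (minimalFrom-strictlyAfter (x , suc y) minus ds)
minimalFrom-completes (eas ∷ ds) x y minus f f-vanishes sw nw se =
  trans (completes-∷ f (snakeCorners (x , y) (eas ∷ ds)) (N (x , y)) rest) (trans (completes-eas x y ds g rest after)
    (cong₂ _∧_ (bothOne (trans at-SW sw) (trans at-NW (cong suc nw)))
      (minimalFrom-completes ds (suc x) y plus g (vanishes f-vanishes) (trans at-SW′ se)
        (trans at-NW′ (cong suc (f-vanishes _ (level-far x y))))
        (trans at-SE′ (f-vanishes _ ≤-refl)))))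
  where
  open EastStep x y true false false f
  rest = minimalFrom (suc x , y) plus ds
  after = All.map proj₁ (minimalFrom-strictlyAfter (suc x , y) plus ds)
minimalFrom-completes (eas ∷ ds) x y plus f f-vanishes sw nw se =
  trans (completes-∷ f (snakeCorners (x , y) (eas ∷ ds)) (S (suc x , y)) rest) (trans (completes-eas x y ds g rest after)
    (cong₂ _∧_ (bothOne (trans at-SW sw) (trans at-NW nw))
      (minimalFrom-completes ds (suc x) y minus g (vanishes f-vanishes) (trans at-SW′ (cong suc se))
        (trans at-NW′ (f-vanishes _ (level-far x y)))
        (trans at-SE′ (cong suc (f-vanishes _ ≤-refl))))))
  where
  open EastStep x y false false true f
  rest = minimalFrom (suc x , y) minus ds
  after = All.map proj₁ (minimalFrom-strictlyAfter (suc x , y) minus ds)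

inTile : Edge → Tile → Bool
inTile e t = elemE e (tileEdges t)

inTile-hor : ∀ (a b p q : ℕ) → (a , b) ≢ (p , q) → (a , b) ≢ (p , suc q) → inTile (hor a b) (p , q) ≡ false
inTile-hor a b p q ne₁ ne₂ rewrite eqP-≢ (a , b) (p , q) ne₁ | eqP-≢ (a , b) (p , suc q) ne₂ = refl

inTile-ver : ∀ (a b p q : ℕ) → (a , b) ≢ (p , q) → (a , b) ≢ (suc p , q) → inTile (ver a b) (p , q) ≡ false
inTile-ver a b p q ne₁ ne₂ rewrite eqP-≢ (a , b) (p , q) ne₁ | eqP-≢ (a , b) (suc p , q) ne₂ = refl

inTile-N : ∀ x y → inTile (N (x , y)) (x , y) ≡ true
inTile-N x y rewrite eqP-≢ (x , suc y) (x , y) (>ʸ⇒≢ ≤-refl) | eqP-refl (x , suc y) = refl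

inTile-E : ∀ x y → inTile (E (x , y)) (x , y) ≡ true
inTile-E x y rewrite eqP-≢ (suc x , y) (x , y) (>ˣ⇒≢ ≤-refl) | eqP-refl (suc x , y) = refl

inTile-S : ∀ x y → inTile (S (x , y)) (x , y) ≡ true
inTile-S x y rewrite eqP-refl (x , y) = refl

inTile-W : ∀ x y → inTile (W (x , y)) (x , y) ≡ true
inTile-W x y rewrite eqP-refl (x , y) = refl

countTiles : Edge → Tile → List Dir → ℕ
countTiles e t ds = countB (inTile e) (tilesFrom t ds)

countTiles-none : ∀ e x y ds → (∀ p q → (x , y) ≼ (p , q) → inTile e (p , q) ≡ false) → countTiles e (x , y) ds ≡ 0
countTiles-none e x y [] none rewrite none x y (≼-refl (x , y)) = refl
countTiles-none e x y (nor ∷ ds) none rewrite none x y (≼-refl (x , y)) =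
  countTiles-none e x (suc y) ds (λ p q (x≤p , sy≤q) → none p q (x≤p , ≤-trans (n≤1+n y) sy≤q))
countTiles-none e x y (eas ∷ ds) none rewrite none x y (≼-refl (x , y)) =
  countTiles-none e (suc x) y ds (λ p q (sx≤p , y≤q) → none p q (≤-trans (n≤1+n x) sx≤p , y≤q))

countTiles-first : ∀ e x y ds → inTile e (x , y) ≡ true →
  (∀ p q → (x , y) ≼ (p , q) → (p , q) ≢ (x , y) → inTile e (p , q) ≡ false) → countTiles e (x , y) ds ≡ 1
countTiles-first e x y [] here′ later rewrite here′ = refl
countTiles-first e x y (nor ∷ ds) here′ later rewrite here′ =
  cong suc (countTiles-none e x (suc y) ds (λ p q (x≤p , sy≤q) → later p q (x≤p , ≤-trans (n≤1+n y) sy≤q) (>ʸ⇒≢ sy≤q)))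
countTiles-first e x y (eas ∷ ds) here′ later rewrite here′ =
  cong suc (countTiles-none e (suc x) y ds (λ p q (sx≤p , y≤q) → later p q (≤-trans (n≤1+n x) sx≤p , y≤q) (>ˣ⇒≢ sx≤p)))

countB-here : ∀ e t ts → inTile e t ≡ true → countB (inTile e) ts ≡ 0 → countB (inTile e) (t ∷ ts) ≡ 1
countB-here e t ts here′ none rewrite here′ | none = refl

countB-skip : ∀ e t ts → inTile e t ≡ false → countB (inTile e) ts ≡ 1 → countB (inTile e) (t ∷ ts) ≡ 1
countB-skip e t ts skip one rewrite skip | one = refl

-- The second conjunct lets the property pass to snakes with more tiles in front.
OnOneTile : Tile → List Dir → Edge → Set
OnOneTile t ds e = (countTiles e t ds ≡ 1) × (∀ p q → (p , q) ≼ t → (p , q) ≢ t → inTile e (p , q) ≡ false)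

notBefore-N : ∀ x y p q → (p , q) ≼ (x , y) → (p , q) ≢ (x , y) → inTile (N (x , y)) (p , q) ≡ false
notBefore-N x y p q (p≤x , q≤y) ne = inTile-hor x (suc y) p q (>ʸ⇒≢ (s≤s q≤y)) (λ { refl → ne refl })

notBefore-E : ∀ x y p q → (p , q) ≼ (x , y) → (p , q) ≢ (x , y) → inTile (E (x , y)) (p , q) ≡ false
notBefore-E x y p q (p≤x , q≤y) ne = inTile-ver (suc x) y p q (>ˣ⇒≢ (s≤s p≤x)) (λ { refl → ne refl })

onOneTile-nor : ∀ x y ds {e} → OnOneTile (x , suc y) ds e → OnOneTile (x , y) (nor ∷ ds) e
onOneTile-nor x y ds {e} (one , notBefore) =
  countB-skip e (x , y) (tilesFrom (x , suc y) ds) (notBefore x y (≤-refl , n≤1+n y) (<ʸ⇒≢ ≤-refl)) one ,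
  λ p q (p≤x , q≤y) ne → notBefore p q (p≤x , ≤-trans q≤y (n≤1+n y)) (<ʸ⇒≢ (s≤s q≤y))

onOneTile-eas : ∀ x y ds {e} → OnOneTile (suc x , y) ds e → OnOneTile (x , y) (eas ∷ ds) e
onOneTile-eas x y ds {e} (one , notBefore) =
  countB-skip e (x , y) (tilesFrom (suc x , y) ds) (notBefore x y (n≤1+n x , ≤-refl) (<ˣ⇒≢ ≤-refl)) one ,
  λ p q (p≤x , q≤y) ne → notBefore p q (≤-trans p≤x (n≤1+n x) , q≤y) (<ˣ⇒≢ (s≤s p≤x))

minimalFrom-onOneTile : ∀ ds x y s → All (OnOneTile (x , y) ds) (minimalFrom (x , y) s ds)
minimalFrom-onOneTile [] x y minus = (countB-here (N (x , y)) (x , y) [] (inTile-N x y) refl , notBefore-N x y) ∷ []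
minimalFrom-onOneTile [] x y plus = (countB-here (E (x , y)) (x , y) [] (inTile-E x y) refl , notBefore-E x y) ∷ []
minimalFrom-onOneTile (nor ∷ ds) x y minus =
  (countB-skip W′ (x , y) (tilesFrom (x , suc y) ds) (inTile-ver x (suc y) x y (>ʸ⇒≢ ≤-refl) (<ˣ⇒≢ ≤-refl))
     (countTiles-first W′ x (suc y) ds (inTile-W x (suc y))
        (λ p q (x≤p , _) ne → inTile-ver x (suc y) p q (λ eq → ne (sym eq)) (<ˣ⇒≢ (s≤s x≤p)))) ,
   λ p q (_ , q≤y) _ → inTile-ver x (suc y) p q (>ʸ⇒≢ (s≤s q≤y)) (>ʸ⇒≢ (s≤s q≤y)))
  ∷ All.map (λ {e} → onOneTile-nor x y ds {e}) (minimalFrom-onOneTile ds x (suc y) plus)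
  where W′ = W (x , suc y)
minimalFrom-onOneTile (nor ∷ ds) x y plus =
  (countB-here (E (x , y)) (x , y) (tilesFrom (x , suc y) ds) (inTile-E x y)
     (countTiles-none (E (x , y)) x (suc y) ds (λ p q (_ , sy≤q) → inTile-ver (suc x) y p q (<ʸ⇒≢ sy≤q) (<ʸ⇒≢ sy≤q))) ,
   notBefore-E x y)
  ∷ All.map (λ {e} → onOneTile-nor x y ds {e}) (minimalFrom-onOneTile ds x (suc y) minus)
minimalFrom-onOneTile (eas ∷ ds) x y minus =
  (countB-here (N (x , y)) (x , y) (tilesFrom (suc x , y) ds) (inTile-N x y)
     (countTiles-none (N (x , y)) (suc x) y ds (λ p q (sx≤p , _) → inTile-hor x (suc y) p q (<ˣ⇒≢ sx≤p) (<ˣ⇒≢ sx≤p))) ,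
   notBefore-N x y)
  ∷ All.map (λ {e} → onOneTile-eas x y ds {e}) (minimalFrom-onOneTile ds (suc x) y plus)
minimalFrom-onOneTile (eas ∷ ds) x y plus =
  (countB-skip S′ (x , y) (tilesFrom (suc x , y) ds) (inTile-hor (suc x) y x y (>ˣ⇒≢ ≤-refl) (>ˣ⇒≢ ≤-refl))
     (countTiles-first S′ (suc x) y ds (inTile-S (suc x) y)
        (λ p q (_ , y≤q) ne → inTile-hor (suc x) y p q (λ eq → ne (sym eq)) (<ʸ⇒≢ (s≤s y≤q)))) ,
   λ p q (p≤x , _) _ → inTile-hor (suc x) y p q (>ˣ⇒≢ (s≤s p≤x)) (>ˣ⇒≢ (s≤s p≤x)))
  ∷ All.map (λ {e} → onOneTile-eas x y ds {e}) (minimalFrom-onOneTile ds (suc x) y minus)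
  where S′ = S (suc x , y)

minimalMatching : Snake → List Edge
minimalMatching G = S (0 , 0) ∷ minimalFrom (0 , 0) minus G

∈-filterB : ∀ {A : Set} (p : A → Bool) {x : A} xs → x ∈ xs → p x ≡ true → x ∈ filterB p xs
∈-filterB p (y ∷ xs) (here refl) px rewrite px = here refl
∈-filterB p (y ∷ xs) (there x∈xs) px with p y
... | true = there (∈-filterB p xs x∈xs px)
... | false = ∈-filterB p xs x∈xs px

allB-All : ∀ {A : Set} (p : A → Bool) xs → All (λ x → p x ≡ true) xs → allB p xs ≡ true
allB-All p [] [] = refl
allB-All p (x ∷ xs) (px ∷ pxs) rewrite px = allB-All p xs pxs

minimalMatching-perfect : ∀ G → isPerfectMatching G (minimalMatching G) ≡ true
minimalMatching-perfect G = trans (isPerfectMatching≡completes G (minimalMatching G))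
  (trans (completes-∷ noDegrees (snakeCorners (0 , 0) G) (S (0 , 0)) (minimalFrom (0 , 0) minus G))
         (minimalFrom-completes G 0 0 minus _ (vanishes-firstEdge G south) refl refl refl))

minimalMatching-∈ : ∀ G → minimalMatching G ∈ perfectMatchings G
minimalMatching-∈ G = ∈-filterB (isPerfectMatching G) (sublists (edges G))
  (subst (λ es → minimalMatching G ∈ sublists es) (sym (edges≡ G))
         (⊆⇒∈sublists (refl ∷ (W (0 , 0) ∷ʳ minimalFrom-⊆ (0 , 0) minus G))))
  (minimalMatching-perfect G)

minimalMatching-minimal : ∀ G → isMinimalMatching G (minimalMatching G) ≡ true
minimalMatching-minimal G = cong (_∧ elemE (S (0 , 0)) (minimalMatching G))
  (allB-All (isBoundary G) (minimalMatching G) (boundary-S ∷ All.map (λ {e} → boundary {e}) (minimalFrom-onOneTile G 0 0 minus)))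
  where
  boundary : ∀ {e} → OnOneTile (0 , 0) G e → isBoundary G e ≡ true
  boundary (one , _) rewrite one = refl
  boundary-S : isBoundary G (S (0 , 0)) ≡ true
  boundary-S rewrite countTiles-first (S (0 , 0)) 0 0 G (inTile-S 0 0)
                       (λ p q _ ne → inTile-hor 0 0 p q (λ eq → ne (sym eq)) (<ʸ⇒≢ (s≤s z≤n))) = refl

-- The band condition

edgeAt : LastEdge → Tile → Edge
edgeAt north t = N t
edgeAt east t = E t

-- The minimal matching uses N (E) of the last tile exactly when its south (west) side is uncovered.
takenWhen : LastEdge → Sign
takenWhen north = minus
takenWhen east = plus

minimalFrom-lastEdge : ∀ ds x y s c′ →
  elemE (edgeAt c′ (lastTileFrom (x , y) ds)) (minimalFrom (x , y) s ds) ≡ eqSign (lastSouthSign s ds) (takenWhen c′)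
minimalFrom-lastEdge [] x y minus north rewrite eqE-refl (N (x , y)) = refl
minimalFrom-lastEdge [] x y minus east = refl
minimalFrom-lastEdge [] x y plus north = refl
minimalFrom-lastEdge [] x y plus east rewrite eqE-refl (E (x , y)) = refl
minimalFrom-lastEdge (nor ∷ ds) x y minus north = minimalFrom-lastEdge ds x (suc y) plus north
minimalFrom-lastEdge (nor ∷ ds) x y minus east
  rewrite eqE-≢ (E (lastTileFrom (x , suc y) ds)) (W (x , suc y)) (>ˣ⇒≢ (s≤s (proj₁ (lastTileFrom-≽ (x , suc y) ds))))
  = minimalFrom-lastEdge ds x (suc y) plus east
minimalFrom-lastEdge (nor ∷ ds) x y plus north = minimalFrom-lastEdge ds x (suc y) minus north
minimalFrom-lastEdge (nor ∷ ds) x y plus east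
  rewrite eqE-≢ (E (lastTileFrom (x , suc y) ds)) (E (x , y)) (>ʸ⇒≢ (proj₂ (lastTileFrom-≽ (x , suc y) ds)))
  = minimalFrom-lastEdge ds x (suc y) minus east
minimalFrom-lastEdge (eas ∷ ds) x y minus north
  rewrite eqE-≢ (N (lastTileFrom (suc x , y) ds)) (N (x , y)) (>ˣ⇒≢ (proj₁ (lastTileFrom-≽ (suc x , y) ds)))
  = minimalFrom-lastEdge ds (suc x) y plus north
minimalFrom-lastEdge (eas ∷ ds) x y minus east = minimalFrom-lastEdge ds (suc x) y plus east
minimalFrom-lastEdge (eas ∷ ds) x y plus north
  rewrite eqE-≢ (N (lastTileFrom (suc x , y) ds)) (S (suc x , y)) (>ʸ⇒≢ (s≤s (proj₂ (lastTileFrom-≽ (suc x , y) ds))))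
  = minimalFrom-lastEdge ds (suc x) y minus north
minimalFrom-lastEdge (eas ∷ ds) x y plus east = minimalFrom-lastEdge ds (suc x) y minus east

isSouth : FirstEdge → Bool
isSouth south = true
isSouth west = false

-- The edge e′ forced by the band condition, given e and the south sign of the last tile.
bandEdge : FirstEdge → Sign → LastEdge
bandEdge west minus = north
bandEdge west plus = east
bandEdge south minus = east
bandEdge south plus = north

bandEdge-unique : ∀ c σ c′ → (isSouth c xor eqSign σ (takenWhen c′)) ≡ true → c′ ≡ bandEdge c σ
bandEdge-unique west minus north _ = refl
bandEdge-unique west plus east _ = refl
bandEdge-unique south minus east _ = refl
bandEdge-unique south plus north _ = refl

band-lastEdge : ∀ G c c′ → BandOK G c c′ → c′ ≡ bandEdge c (lastSouthSign minus G)
band-lastEdge G c c′ band = bandEdge-unique c (lastSouthSign minus G) c′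
  (trans (sym (cong₂ _xor_ (firstEdge-∈ c) lastEdge-∈))
         (band (minimalMatching G) (minimalMatching-∈ G) (minimalMatching-minimal G)))
  where
  rest = minimalFrom (0 , 0) minus G
  firstEdge-∈ : ∀ c → elemE (firstEdge G c) (minimalMatching G) ≡ isSouth c
  firstEdge-∈ south = refl
  firstEdge-∈ west = firstEdge-fresh G west rest (minimalFrom-strictlyAfter (0 , 0) minus G)
  lastEdge-∈ : elemE (lastEdge G c′) (minimalMatching G) ≡ eqSign (lastSouthSign minus G) (takenWhen c′)
  lastEdge-∈ = trans (cong (_∨ elemE (lastEdge G c′) rest) (lastEdge-≢-firstEdge G south c′))
                     (trans (cong (λ e → elemE e rest) (lastEdge≡ c′)) (minimalFrom-lastEdge G 0 0 minus c′))
    where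
    lastEdge≡ : ∀ c′ → lastEdge G c′ ≡ edgeAt c′ (lastTileFrom (0 , 0) G)
    lastEdge≡ north = refl
    lastEdge≡ east = refl

-- Good matchings

goodCount+avoiding : ∀ G c c′ →
  goodCount G c c′ + countSublists (λ M → isPerfectMatching G M ∧ avoids G c c′ M) (edges G)
  ≡ countSublists (isPerfectMatching G) (edges G)
goodCount+avoiding G c c′ =
  trans (cong (_+ countSublists (λ M → isPerfectMatching G M ∧ avoids G c c′ M) (edges G))
              (length-filterB-filterB (isPerfectMatching G) good (sublists (edges G))))
        (sym (length-filterB-split (isPerfectMatching G) good (sublists (edges G))))
  where
  good : List Edge → Bool
  good M = elemE (firstEdge G c) M ∨ elemE (lastEdge G c′) M

contPair-blockList : ∀ G r m → r ≡ blockChange m (finalSigns minus minus G) →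
  contPair (adjustLast r (blockList G)) ≡ (1 * throughS m G + throughW m G , throughS m G)
contPair-blockList G r m refl = contPair-blocks G minus minus 1 m

throughS+throughW : ∀ G → throughS free G + throughW free G ≡ proj₁ (contPair (blockList G))
throughS+throughW G = sym (begin
  proj₁ (contPair (blockList G))                       ≡⟨ cong (λ L → proj₁ (contPair L)) (adjustLast-keep (blockList G)) ⟨
  proj₁ (contPair (adjustLast keep (blockList G)))     ≡⟨ cong proj₁ (contPair-blockList G keep free refl) ⟩
  1 * throughS free G + throughW free G                ≡⟨ cong (_+ throughW free G) (*-identityˡ _) ⟩
  throughS free G + throughW free G                    ∎)
  where open ≡-Reasoning

goodCount+through : ∀ G c c′ →
  goodCount G c c′ + through (otherFirst c) (constraintOf c′) G ≡ proj₁ (contPair (blockList G))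
goodCount+through G c c′ = begin
  goodCount G c c′ + through (otherFirst c) (constraintOf c′) G
    ≡⟨ cong (goodCount G c c′ +_) (avoidingMatchings-count G c c′) ⟨
  goodCount G c c′ + countSublists (λ M → isPerfectMatching G M ∧ avoids G c c′ M) (edges G)
    ≡⟨ goodCount+avoiding G c c′ ⟩
  countSublists (isPerfectMatching G) (edges G)
    ≡⟨ perfectMatchings-count G ⟩
  throughS free G + throughW free G
    ≡⟨ throughS+throughW G ⟩
  proj₁ (contPair (blockList G)) ∎
  where open ≡-Reasoning

-- The adjustment of the last block that corresponds to forbidding e′, by parity of the number of blocks.
endChange : FirstEdge → Bool → LastBlock
endChange west odd = if odd then drop else decrement
endChange south odd = if odd then decrement else drop

endChange-band : ∀ c p → blockChange (constraintOf (bandEdge c (proj₂ p))) p ≡ endChange c (eqSign minus (proj₁ p))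
endChange-band west (plus , plus) = refl
endChange-band west (plus , minus) = refl
endChange-band west (minus , plus) = refl
endChange-band west (minus , minus) = refl
endChange-band south (plus , plus) = refl
endChange-band south (plus , minus) = refl
endChange-band south (minus , plus) = refl
endChange-band south (minus , minus) = refl

endChange≡blockChange : ∀ G c c′ → BandOK G c c′ →
  endChange c (isOdd (length (blockList G))) ≡ blockChange (constraintOf c′) (finalSigns minus minus G)
endChange≡blockChange G c c′ band = begin
  endChange c (isOdd (length (blockList G)))
    ≡⟨ cong (endChange c) (isOdd-#blockList G) ⟩
  endChange c (eqSign minus (proj₁ (finalSigns minus minus G)))
    ≡⟨ endChange-band c (finalSigns minus minus G) ⟨
  blockChange (constraintOf (bandEdge c (proj₂ (finalSigns minus minus G)))) (finalSigns minus minus G)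
    ≡⟨ cong (λ σ → blockChange (constraintOf (bandEdge c σ)) (finalSigns minus minus G)) (finalSigns-south minus minus G) ⟩
  blockChange (constraintOf (bandEdge c (lastSouthSign minus G))) (finalSigns minus minus G)
    ≡⟨ cong (λ c′ → blockChange (constraintOf c′) (finalSigns minus minus G)) (band-lastEdge G c c′ band) ⟨
  blockChange (constraintOf c′) (finalSigns minus minus G) ∎
  where open ≡-Reasoning

goodCount-west : ∀ G c′ → BandOK G west c′ →
  goodCount G west c′ + proj₂ (contPair (adjustLast (endChange west (isOdd (length (blockList G)))) (blockList G)))
  ≡ proj₁ (contPair (blockList G))
goodCount-west G c′ band =
  trans (cong (λ pq → goodCount G west c′ + proj₂ pq)
              (contPair-blockList G _ (constraintOf c′) (endChange≡blockChange G west c′ band)))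
        (goodCount+through G west c′)

goodCount-south : ∀ G c′ → BandOK G south c′ →
  let pq = contPair (adjustLast (endChange south (isOdd (length (blockList G)))) (blockList G)) in
  goodCount G south c′ + (proj₁ pq ∸ proj₂ pq) ≡ proj₁ (contPair (blockList G))
goodCount-south G c′ band =
  trans (cong (λ pq → goodCount G south c′ + (proj₁ pq ∸ proj₂ pq))
              (contPair-blockList G _ m (endChange≡blockChange G south c′ band)))
        (trans (cong (goodCount G south c′ +_) p∸q) (goodCount+through G south c′))
  where
  m = constraintOf c′
  p∸q : 1 * throughS m G + throughW m G ∸ throughS m G ≡ throughW m G
  p∸q = trans (cong (λ X → X + throughW m G ∸ throughS m G) (*-identityˡ _)) (m+n∸m≡n (throughS m G) _)

data StartsEast : Snake → Set where
  oneTile : StartsEast []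
  east : ∀ ds → StartsEast (eas ∷ ds)

-- A north step first would make the first block of the sign sequence have length 1.
startsEast : ∀ G a₁ rest → IsSnakeOf G (a₁ ∷ rest) → 1 < a₁ → StartsEast G
startsEast [] a₁ rest _ _ = oneTile
startsEast (eas ∷ ds) a₁ rest _ _ = east ds
startsEast (nor ∷ ds) a₁ rest isSnake 1<a₁ with cong (λ { [] → 0 ; (b ∷ _) → b }) isSnake
... | refl = ⊥-elim (<-irrefl refl 1<a₁)

-- After an east step the south edge of G₁ shares its corner (1 , 0) with G₂.
south-notDominant : ∀ ds → isDominant (eas ∷ ds) south ≡ false
south-notDominant [] = refl
south-notDominant (nor ∷ ds) = ∧-zeroʳ _
south-notDominant (eas ∷ ds) = ∧-zeroʳ _

dominant-west : ∀ ds c → isDominant (eas ∷ ds) c ≡ true → c ≡ west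
dominant-west ds west _ = refl
dominant-west ds south dom with trans (sym dom) (south-notDominant ds)
... | ()

nonDominant-south : ∀ ds c → isNonDominant (eas ∷ ds) c ≡ true → c ≡ south
nonDominant-south ds south _ = refl
nonDominant-south ds west nonDom with trans (sym nonDom) (south-notDominant ds)
... | ()

singleTile-goodCount : ∀ c c′ → BandOK [] c c′ → goodCount [] c c′ ≡ 2
singleTile-goodCount west c′ band = trans (sym (+-identityʳ _)) (goodCount-west [] c′ band)
singleTile-goodCount south c′ band = trans (sym (+-identityʳ _)) (goodCount-south [] c′ band)

isOdd-#blockList≡ : ∀ G a₁ mid aₙ → IsSnakeOf G (a₁ ∷ mid ++ aₙ ∷ []) →
  isOdd (length (blockList G)) ≡ isOdd (2 + length mid)
isOdd-#blockList≡ G a₁ mid aₙ isSnake =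
  cong isOdd (trans (cong length isSnake) (cong suc (trans (length-++ mid) (+-comm (length mid) 1))))

numerator-blockList : ∀ G a → IsSnakeOf G a → proj₁ (contPair (blockList G)) ≡ cfNum a
numerator-blockList G a isSnake = trans (cong (λ L → proj₁ (contPair L)) isSnake) (sym (cfNum≡numerator a))

singleTile-¬severalBlocks : ∀ a₁ mid aₙ → ¬ IsSnakeOf [] (a₁ ∷ mid ++ aₙ ∷ [])
singleTile-¬severalBlocks a₁ [] aₙ ()
singleTile-¬severalBlocks a₁ (_ ∷ mid) aₙ ()

dominant-goodCount : ∀ a₁ mid aₙ L → 1 < a₁ →
  adjustLast (endChange west (isOdd (2 + length mid))) (a₁ ∷ mid ++ aₙ ∷ []) ≡ a₁ ∷ L →
  ∀ G → IsSnakeOf G (a₁ ∷ mid ++ aₙ ∷ []) → ∀ c → isDominant G c ≡ true → ∀ c′ → BandOK G c c′ →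
  goodCount G c c′ + cfNum L ≡ cfNum (a₁ ∷ mid ++ aₙ ∷ [])
dominant-goodCount a₁ mid aₙ L 1<a₁ adjusted G isSnake c dom c′ band with startsEast G a₁ (mid ++ aₙ ∷ []) isSnake 1<a₁
... | oneTile = ⊥-elim (singleTile-¬severalBlocks a₁ mid aₙ isSnake)
... | east ds with dominant-west ds c dom
... | refl = trans (cong (goodCount G west c′ +_) denominator) (trans (goodCount-west G c′ band) (numerator-blockList G _ isSnake))
  where
  denominator : cfNum L ≡ proj₂ (contPair (adjustLast (endChange west (isOdd (length (blockList G)))) (blockList G)))
  denominator = sym (begin
    proj₂ (contPair (adjustLast (endChange west (isOdd (length (blockList G)))) (blockList G)))
      ≡⟨ cong₂ (λ b L′ → proj₂ (contPair (adjustLast (endChange west b) L′))) (isOdd-#blockList≡ G a₁ mid aₙ isSnake) isSnake ⟩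
    proj₂ (contPair (adjustLast (endChange west (isOdd (2 + length mid))) (a₁ ∷ mid ++ aₙ ∷ [])))
      ≡⟨ cong (λ L′ → proj₂ (contPair L′)) adjusted ⟩
    proj₂ (contPair (a₁ ∷ L))
      ≡⟨ denominator-∷ a₁ L ⟩
    cfNum L ∎)
    where open ≡-Reasoning

nonDominant-goodCount : ∀ a₁ mid aₙ L → 1 < a₁ →
  adjustLast (endChange south (isOdd (2 + length mid))) (a₁ ∷ mid ++ aₙ ∷ []) ≡ a₁ ∷ L →
  ∀ G → IsSnakeOf G (a₁ ∷ mid ++ aₙ ∷ []) → ∀ c → isNonDominant G c ≡ true → ∀ c′ → BandOK G c c′ →
  goodCount G c c′ + cfNum ((a₁ ∸ 1) ∷ L) ≡ cfNum (a₁ ∷ mid ++ aₙ ∷ [])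
nonDominant-goodCount a₁ mid aₙ L 1<a₁ adjusted G isSnake c nonDom c′ band with startsEast G a₁ (mid ++ aₙ ∷ []) isSnake 1<a₁
... | oneTile = ⊥-elim (singleTile-¬severalBlocks a₁ mid aₙ isSnake)
... | east ds with nonDominant-south ds c nonDom
... | refl = trans (cong (goodCount G south c′ +_) difference) (trans (goodCount-south G c′ band) (numerator-blockList G _ isSnake))
  where
  pq = contPair (adjustLast (endChange south (isOdd (length (blockList G)))) (blockList G))
  difference : cfNum ((a₁ ∸ 1) ∷ L) ≡ proj₁ pq ∸ proj₂ pq
  difference = sym (begin
    proj₁ pq ∸ proj₂ pq
      ≡⟨ cong₂ (λ b L′ → let pq′ = contPair (adjustLast (endChange south b) L′) in proj₁ pq′ ∸ proj₂ pq′)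
               (isOdd-#blockList≡ G a₁ mid aₙ isSnake) isSnake ⟩
    (let pq′ = contPair (adjustLast (endChange south (isOdd (2 + length mid))) (a₁ ∷ mid ++ aₙ ∷ [])) in proj₁ pq′ ∸ proj₂ pq′)
      ≡⟨ cong (λ L′ → proj₁ (contPair L′) ∸ proj₂ (contPair L′)) adjusted ⟩
    proj₁ (contPair (a₁ ∷ L)) ∸ proj₂ (contPair (a₁ ∷ L))
      ≡⟨ numerator-∸-denominator a₁ L (<⇒≤ 1<a₁) ⟩
    cfNum ((a₁ ∸ 1) ∷ L) ∎)
    where open ≡-Reasoning

singleBlock-dominant : ∀ a₁ → 1 < a₁ → ∀ G → IsSnakeOf G (a₁ ∷ []) → ∀ c → isDominant G c ≡ true →
  ∀ c′ → BandOK G c c′ → goodCount G c c′ ≡ a₁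
singleBlock-dominant a₁ 1<a₁ G isSnake c dom c′ band with startsEast G a₁ [] isSnake 1<a₁
... | oneTile = trans (singleTile-goodCount c c′ band) (cong (λ { [] → 0 ; (b ∷ _) → b }) isSnake)
... | east ds with dominant-west ds c dom
... | refl = trans (sym (+-identityʳ _)) (trans (cong (goodCount G west c′ +_) (sym dropped)) (trans (goodCount-west G c′ band) numerator))
  where
  odd : isOdd (length (blockList G)) ≡ true
  odd = cong (λ L → isOdd (length L)) isSnake
  dropped : proj₂ (contPair (adjustLast (endChange west (isOdd (length (blockList G)))) (blockList G))) ≡ 0
  dropped = cong₂ (λ b L → proj₂ (contPair (adjustLast (endChange west b) L))) odd isSnake
  numerator : proj₁ (contPair (blockList G)) ≡ a₁
  numerator = trans (cong (λ L → proj₁ (contPair L)) isSnake) (trans (+-identityʳ _) (*-identityʳ a₁))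

singleBlock-nonDominant : ∀ a₁ → 1 < a₁ → ∀ G → IsSnakeOf G (a₁ ∷ []) → ∀ c → isNonDominant G c ≡ true →
  ∀ c′ → BandOK G c c′ → goodCount G c c′ ≡ 2
singleBlock-nonDominant a₁ 1<a₁ G isSnake c nonDom c′ band with startsEast G a₁ [] isSnake 1<a₁
singleBlock-nonDominant a₁ 1<a₁ G isSnake c nonDom c′ band | oneTile = singleTile-goodCount c c′ band
singleBlock-nonDominant (suc zero) (s≤s ()) G isSnake c nonDom c′ band | east ds
singleBlock-nonDominant (suc (suc k)) 1<a₁ G isSnake c nonDom c′ band | east ds with nonDominant-south ds c nonDom
... | refl = +-cancelʳ-≡ (k * 1 + 0) (goodCount G south c′) 2
               (trans (cong (goodCount G south c′ +_) (sym decremented)) (trans (goodCount-south G c′ band) numerator))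
  where
  odd : isOdd (length (blockList G)) ≡ true
  odd = cong (λ L → isOdd (length L)) isSnake
  decremented : let pq = contPair (adjustLast (endChange south (isOdd (length (blockList G)))) (blockList G)) in
    proj₁ pq ∸ proj₂ pq ≡ k * 1 + 0
  decremented = cong₂ (λ b L → let pq = contPair (adjustLast (endChange south b) L) in proj₁ pq ∸ proj₂ pq) odd isSnake
  numerator : proj₁ (contPair (blockList G)) ≡ 2 + (k * 1 + 0)
  numerator = cong (λ L → proj₁ (contPair L)) isSnake

open import Data.Integer using (+_; _-_)
open import Data.Integer.Properties using (m-n≡m⊖n; ⊖-≥)

sum≡⇒difference : ∀ g b n → g + b ≡ n → + g ≡ + n - + b
sum≡⇒difference g b n refl = sym (trans (m-n≡m⊖n (g + b) b) (trans (⊖-≥ (m≤n+m b g)) (cong +_ (m+n∸n≡m g b))))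

even⇒¬isOdd : ∀ n → n % 2 ≡ 0 → isOdd n ≡ false
even⇒¬isOdd n even with isOdd n | %2≡isOdd n
... | false | _ = refl
... | true | n%2≡1 = ⊥-elim (1≢0 (trans (sym n%2≡1) even))
  where
  1≢0 : 1 ≢ 0
  1≢0 ()

odd⇒isOdd : ∀ n → n % 2 ≡ 1 → isOdd n ≡ true
odd⇒isOdd n odd with isOdd n | %2≡isOdd n
... | true | _ = refl
... | false | n%2≡0 = ⊥-elim (0≢1 (trans (sym n%2≡0) odd))
  where
  0≢1 : 0 ≢ 1
  0≢1 ()

NcircD-several : ∀ a₁ mid aₙ L → 1 < a₁ →
  adjustLast (endChange west (isOdd (2 + length mid))) (a₁ ∷ mid ++ aₙ ∷ []) ≡ a₁ ∷ L →
  NcircD≡ (a₁ ∷ mid ++ aₙ ∷ []) (+ cfNum (a₁ ∷ mid ++ aₙ ∷ []) - + cfNum L)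
NcircD-several a₁ mid aₙ L 1<a₁ adjusted G isSnake c dom c′ band =
  sum≡⇒difference _ _ _ (dominant-goodCount a₁ mid aₙ L 1<a₁ adjusted G isSnake c dom c′ band)

NcircN-several : ∀ a₁ mid aₙ L → 1 < a₁ →
  adjustLast (endChange south (isOdd (2 + length mid))) (a₁ ∷ mid ++ aₙ ∷ []) ≡ a₁ ∷ L →
  NcircN≡ (a₁ ∷ mid ++ aₙ ∷ []) (+ cfNum (a₁ ∷ mid ++ aₙ ∷ []) - + cfNum ((a₁ ∸ 1) ∷ L))
NcircN-several a₁ mid aₙ L 1<a₁ adjusted G isSnake c nonDom c′ band =
  sum≡⇒difference _ _ _ (nonDominant-goodCount a₁ mid aₙ L 1<a₁ adjusted G isSnake c nonDom c′ band)

NcircD-single : ∀ a₁ → 1 < a₁ → NcircD≡ (a₁ ∷ []) (+ a₁)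
NcircD-single a₁ 1<a₁ G isSnake c dom c′ band = cong +_ (singleBlock-dominant a₁ 1<a₁ G isSnake c dom c′ band)

NcircN-single : ∀ a₁ → 1 < a₁ → NcircN≡ (a₁ ∷ []) (+ 2)
NcircN-single a₁ 1<a₁ G isSnake c nonDom c′ band = cong +_ (singleBlock-nonDominant a₁ 1<a₁ G isSnake c nonDom c′ band)

adjustLast-parity : ∀ c n {b} L → isOdd n ≡ b → adjustLast (endChange c (isOdd n)) L ≡ adjustLast (endChange c b) L
adjustLast-parity c n L odd≡ = cong (λ b → adjustLast (endChange c b) L) odd≡

proposition5p4 :
    ((a₁ : ℕ) (mid : List ℕ) (aₙ : ℕ) →
      1 < a₁ → All (0 <_) mid → 1 < aₙ →
      (((2 + length mid) % 2 ≡ 0 →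
          NcircD≡ (a₁ ∷ mid ++ aₙ ∷ []) (+ cfNum (a₁ ∷ mid ++ aₙ ∷ []) - + cfNum (mid ++ (aₙ ∸ 1) ∷ []))
        × NcircN≡ (a₁ ∷ mid ++ aₙ ∷ []) (+ cfNum (a₁ ∷ mid ++ aₙ ∷ []) - + cfNum ((a₁ ∸ 1) ∷ mid)))
      × ((2 + length mid) % 2 ≡ 1 →
          NcircD≡ (a₁ ∷ mid ++ aₙ ∷ []) (+ cfNum (a₁ ∷ mid ++ aₙ ∷ []) - + cfNum mid)
        × NcircN≡ (a₁ ∷ mid ++ aₙ ∷ []) (+ cfNum (a₁ ∷ mid ++ aₙ ∷ []) - + cfNum ((a₁ ∸ 1) ∷ mid ++ (aₙ ∸ 1) ∷ [])))))
    × ((a₁ : ℕ) → 1 < a₁ → NcircD≡ (a₁ ∷ []) (+ a₁) × NcircN≡ (a₁ ∷ []) (+ 2))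
proposition5p4 =
    (λ a₁ mid aₙ 1<a₁ _ _ →
        (λ even → let n = 2 + length mid ; a = a₁ ∷ mid ++ aₙ ∷ [] ; odd≡ = even⇒¬isOdd n even in
             NcircD-several a₁ mid aₙ _ 1<a₁ (trans (adjustLast-parity west n a odd≡) (adjustLast-decrement a₁ mid aₙ))
           , NcircN-several a₁ mid aₙ _ 1<a₁ (trans (adjustLast-parity south n a odd≡) (adjustLast-drop a₁ mid aₙ)))
      , (λ odd → let n = 2 + length mid ; a = a₁ ∷ mid ++ aₙ ∷ [] ; odd≡ = odd⇒isOdd n odd in
             NcircD-several a₁ mid aₙ _ 1<a₁ (trans (adjustLast-parity west n a odd≡) (adjustLast-drop a₁ mid aₙ))
           , NcircN-several a₁ mid aₙ _ 1<a₁ (trans (adjustLast-parity south n a odd≡) (adjustLast-decrement a₁ mid aₙ))))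
  , (λ a₁ 1<a₁ → NcircD-single a₁ 1<a₁ , NcircN-single a₁ 1<a₁)
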